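{- Let $n\ge 1$. (i) There is a bijection $(P,Q)\mapsto T$ from $\mathcal{D}_n\times\mathcal{D}_n$ onto $\mathcal{M}_n$ such that $\mathsf{traj}(P,Q)=\mathsf{comp}(T)$. (ii) There is a bijection $P\mapsto S$ from $\mathcal{D}_n$ onto $\mathcal{M}^*_n$ such that $\mathsf{traj}(P)=\mathsf{comp}(S)$.
   Context: A Dyck path of size $n$ is a lattice path in $\mathbb{Z}^2$ from $(0,0)$ to $(n,n)$ using north steps $\mathsf{N}=(0,1)$ and east steps $\mathsf{E}=(1,0)$ that never goes below the line $y=x$; $\mathcal{D}_n$ is the set of such paths. For a Dyck path $P$, $-P$ denotes the path obtained by reflecting $P$ over the line $y=x$. For $P,Q\in\mathcal{D}_n$, the grid polygon associated with $(P,Q)$ is the region enclosed by $P$ and $-Q$; its boundary consists of the $4n$ unit steps of $P$ and $-Q$. From the midpoint of any boundary step, emit a light beam into the interior of the polygon making a $45^\circ$ angle with that step; it travels in a straight line until it reaches the midpoint of another boundary step (meeting it at $45^\circ$). This defines a permutation $\pi$ of the $4n$ boundary steps; its cycles are the (billiard) trajectories, and $\mathsf{traj}(P,Q)$ denotes the number of cycles of $\pi$. With $L_n=\mathsf{N}^n\mathsf{E}^n$, set $\mathsf{traj}(P)=\mathsf{traj}(P,L_n)$ for $P\in\mathcal{D}_n$. A meander of order $n$ is a collection of closed, self-avoiding, mutually noncrossing curves in the plane that intersect a fixed straight line in exactly $2n$ fixed points (and nowhere else), considered up to smooth deformation; $\mathcal{M}_n$ is the set of (inequivalent) meanders of order $n$.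 A semimeander of order $n$ is defined the same way with a fixed ray and $n$ fixed points on it; $\mathcal{M}^*_n$ is the set of semimeanders of order $n$. For a meander or semimeander $T$, $\mathsf{comp}(T)$ is its number of connected components (closed curves). -}

module Defs where

open import Data.Bool using (Bool; true; false; T; _∧_; not; if_then_else_; _xor_)
open import Data.Nat using (ℕ; zero; suc; _+_; _∸_; _≡ᵇ_; _<ᵇ_; _≤ᵇ_)
open import Data.Fin using (Fin; toℕ; opposite) renaming (zero to fzero; suc to fsuc)
open import Data.Vec using (Vec; []; _∷_; lookup; _++_; replicate; map; allFin; toList)
open import Data.List.Base using (List; all; upTo)
open import Data.Product using (Σ; _×_; _,_; proj₁; proj₂)
open import Data.Maybe using (Maybe; just; nothing; fromMaybe) renaming (map to mapMaybe)

countTrue : List Bool → ℕ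
countTrue Data.List.Base.[] = 0
countTrue (true Data.List.Base.∷ bs) = suc (countTrue bs)
countTrue (false Data.List.Base.∷ bs) = countTrue bs

countFin : ∀ {m} → (Fin m → Bool) → ℕ
countFin {m} p = countTrue (toList (map p (allFin m)))

iter : ∀ {A : Set} → (A → A) → ℕ → A → A
iter f zero x = x
iter f (suc k) x = f (iter f k x)

-- Number of cycles of a map f : Fin m → Fin m (f is a permutation in
-- our uses): count the i that are the least element of their orbit
-- {f^k i | k ≤ m}.
numCycles : ∀ {m} → (Fin m → Fin m) → ℕ
numCycles {m} f =
  countFin (λ i → all (λ k → toℕ i ≤ᵇ toℕ (iter f k i)) (upTo (suc m)))

even : ℕ → Bool
even zero = true
even (suc k) = not (even k)

-- N = (0,1) north step, E = (1,0) east step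
data Step : Set where
  N E : Step

-- dyckFrom c w : reading w from a point at height c above the diagonal
-- (c = #N - #E so far), never goes below y = x and ends on it.
dyckFrom : ∀ {m} → ℕ → Vec Step m → Bool
dyckFrom c [] = c ≡ᵇ 0
dyckFrom c (N ∷ w) = dyckFrom (suc c) w
dyckFrom zero (E ∷ w) = false
dyckFrom (suc c) (E ∷ w) = dyckFrom c w

isDyck : ∀ {m} → Vec Step m → Bool
isDyck = dyckFrom 0

-- 𝒟_n : Dyck paths of size n, from (0,0) to (n,n) (length 2n = n + n).
-- The side condition is Bool-valued, so proofs of it are unique and
-- DyckPath n is in bijection with the set of Dyck words.
DyckPath : ℕ → Set
DyckPath n = Σ (Vec Step (n + n)) (λ w → T (isDyck w))

Lword : (n : ℕ) → Vec Step (n + n)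
Lword n = replicate n N ++ replicate n E

flipStep : Step → Step
flipStep N = E
flipStep E = N

negPath : ∀ {m} → Vec Step m → Vec Step m
negPath = map flipStep

-- Unit segments of the grid:
--   H a b : horizontal segment from (a,b) to (a+1,b)
--   V c k : vertical   segment from (c,k) to (c,k+1)
data Edge : Set where
  H V : ℕ → ℕ → Edge

_==ᴱ_ : Edge → Edge → Bool
H a b ==ᴱ H c d = (a ≡ᵇ c) ∧ (b ≡ᵇ d)
V a b ==ᴱ V c d = (a ≡ᵇ c) ∧ (b ≡ᵇ d)
_ ==ᴱ _ = false

pathEdges : ∀ {m} → ℕ → ℕ → Vec Step m → Vec Edge m
pathEdges x y [] = []
pathEdges x y (N ∷ w) = V x y ∷ pathEdges x (suc y) w
pathEdges x y (E ∷ w) = H x y ∷ pathEdges (suc x) y w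

-- height of the (a+1)-th E step of a path started at height y
-- (0 if there is no such step)
heightOfEStep : ∀ {m} → ℕ → ℕ → Vec Step m → ℕ
heightOfEStep y a [] = 0
heightOfEStep y a (N ∷ w) = heightOfEStep (suc y) a w
heightOfEStep y zero (E ∷ w) = y
heightOfEStep y (suc a) (E ∷ w) = heightOfEStep y a w

module Billiards {n : ℕ} (P Q : Vec Step (n + n)) where

  boundary : Vec Edge ((n + n) + (n + n))
  boundary = pathEdges 0 0 P ++ pathEdges 0 0 (negPath Q)

  -- In column a, -Q runs at height heightOfEStep 0 a (-Q) and
  -- P at height heightOfEStep 0 a P.  (For a ≥ n no cell is inside.)
  cellInside : ℕ → ℕ → Bool
  cellInside a b =
    (heightOfEStep 0 a (negPath Q) ≤ᵇ b) ∧ (b <ᵇ heightOfEStep 0 a P)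

  -- a segment lies on the boundary iff exactly one adjacent cell is inside
  isBoundary : Edge → Bool
  isBoundary (H a zero) = cellInside a zero
  isBoundary (H a (suc b)) = cellInside a (suc b) xor cellInside a b
  isBoundary (V zero k) = cellInside zero k
  isBoundary (V (suc c) k) = cellInside (suc c) k xor cellInside c k

  -- Diagonal directions (dx positive? , dy positive?)
  Dir : Set
  Dir = Bool × Bool

  -- Direction of the beam emitted from (the midpoint of) a boundary
  -- step into the interior at 45° with the step.  The vertical component
  -- (for H) / horizontal component (for V) points into the interior;
  -- the other component is fixed by the parity convention below, which
  -- makes the emission direction at every step equal to the reflection
  -- of the incoming beam, so π is the billiard map.
  emit : Edge → Dir
  emit (H a b) = (even (a + b) , cellInside a b)
  emit (V c k) = (cellInside c k , not (even (c + k)))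

  -- the beam travels from the midpoint of a segment, through half a
  -- cell, to the midpoint of the next segment it meets
  step : Edge → Dir → Edge
  step (H a b) (dx , dy) =
    V (if dx then suc a else a) (if dy then b else b ∸ 1)
  step (V c k) (dx , dy) =
    H (if dx then c else c ∸ 1) (if dy then suc k else k)

  -- follow the beam until it meets the boundary (fuel: a beam inside
  -- [0,n]² makes at most 2n half-cell moves, so fuel 4n suffices)
  fly : ℕ → Edge → Dir → Edge
  fly zero e d = e
  fly (suc f) e d =
    let e′ = step e d in if isBoundary e′ then e′ else fly f e′ d

  indexOf : ∀ {m} → Vec Edge m → Edge → Maybe (Fin m)
  indexOf [] e = nothing
  indexOf (x ∷ xs) e = if x ==ᴱ e then just fzero else mapMaybe fsuc (indexOf xs e)

  π : Fin ((n + n) + (n + n)) → Fin ((n + n) + (n + n))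
  π i = let e = lookup boundary i in
        fromMaybe i (indexOf boundary (fly ((n + n) + (n + n)) e (emit e)))

traj : ∀ {n} → DyckPath n → DyckPath n → ℕ
traj {n} P Q = numCycles (Billiards.π {n} (proj₁ P) (proj₁ Q))

traj₁ : ∀ {n} → DyckPath n → ℕ
traj₁ {n} P = numCycles (Billiards.π {n} (proj₁ P) (Lword n))

isNCPerfectMatching : ∀ {m} → (Fin m → Fin m) → Bool
isNCPerfectMatching {m} f =
  all (λ i → not (toℕ (f i) ≡ᵇ toℕ i) ∧ (toℕ (f (f i)) ≡ᵇ toℕ i)) is ∧
  all (λ i → all (λ j → not ((toℕ i <ᵇ toℕ j) ∧ (toℕ j <ᵇ toℕ (f i))
                               ∧ (toℕ (f i) <ᵇ toℕ (f j)))) is) is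
  where is = toList (allFin m)

-- arch system: the arcs of the curves on one side of the line
ArchSystem : ℕ → Set
ArchSystem m = Σ (Vec (Fin m) m) (λ v → T (isNCPerfectMatching (lookup v)))

-- number of closed curves formed by upper arcs U and lower arcs L:
-- the curve through i visits exactly the points (L∘U)^k i and U((L∘U)^k i);
-- count the i that are least on their curve
curves : ∀ {m} → (Fin m → Fin m) → (Fin m → Fin m) → ℕ
curves {m} U L = countFin (λ i → all (λ k →
  (toℕ i ≤ᵇ toℕ (iter (λ x → L (U x)) k i)) ∧
  (toℕ i ≤ᵇ toℕ (U (iter (λ x → L (U x)) k i)))) (upTo (suc m)))

-- ℳ_n : a meander of order n is determined (up to deformation) by its
-- upper and lower arch systems on the 2n points of the line.
Meander : ℕ → Set
Meander n = ArchSystem (n + n) × ArchSystem (n + n)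

compM : ∀ {n} → Meander n → ℕ
compM (U , L) = curves (lookup (proj₁ U)) (lookup (proj₁ L))

-- ℳ*_n : cutting the plane along the ray and unfolding (z ↦ √z) the two
-- sides of the ray become a line carrying 2n points
-- (-√n < … < -√1 < √1 < … < √n), the curves become an arch system on
-- them, and the two sides of the k-th point of the ray are the points
-- i and 2n-1-i  (the "rainbow", Data.Fin.opposite).
Semimeander : ℕ → Set
Semimeander n = ArchSystem (n + n)

compS : ∀ {n} → Semimeander n → ℕ
compS S = curves (lookup (proj₁ S)) opposite

-- Both bijections send a Dyck path to its arch system, the noncrossing perfect matching of its
-- steps that pairs each N step with the E step at which the path first returns to the same height
-- (conversely, step i of the word is N exactly when its partner lies to its right).
--
-- Number the 4n boundary steps of the polygon as the steps 0, …, 2n - 1 of P followed by those of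
-- -Q. Step k of P and step k of -Q have their midpoints on the antidiagonal x + y = k + ½, which
-- joins them inside the polygon, and the diagonal through the midpoints of two matched steps of P
-- (or of Q) stays inside it as well. The parity convention of the billiard sends the beam along
-- the antidiagonal from even steps of P and odd steps of -Q, and along the diagonal to the matched
-- step otherwise. So the billiard permutation alternates between the arch system U of P and the
-- arch system L of Q glued along the line: its cycles are the closed curves of the meander (U, L),
-- and comparing least elements of cycles gives traj = comp. The arch system of L_n is the rainbow
-- i ↦ 2n - 1 - i, which is how a semimeander is encoded.

module Submission where

open import Defs
open import Data.Bool using (Bool; true; false; T; _∧_; not; if_then_else_; _xor_)
open import Data.Bool.Properties using (∧-comm; ∧-zeroʳ; not-involutive; xor-identityʳ; T-≡; T-irrelevant)
open import Data.Empty using (⊥; ⊥-elim)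
open import Data.Fin using (Fin; toℕ; fromℕ<; opposite) renaming (zero to fzero; suc to fsuc)
open import Data.Fin.Properties using (toℕ<n; toℕ-fromℕ<; toℕ-injective; pigeonhole; opposite-prop)
open import Data.List.Base using (List; all; upTo; applyUpTo)
import Data.List.Base as List
open import Data.Maybe using (just)
open import Data.Nat
open import Data.Nat.DivMod using (_/_; _%_; m≡m%n+[m/n]*n; m%n<n)
open import Data.Nat.Properties
import Data.Nat.Solver
open import Data.Product using (Σ; Σ-syntax; _×_; _,_; proj₁; proj₂)
open import Data.Product.Function.NonDependent.Propositional using (_×-⤖_)
open import Data.Sum using (_⊎_; inj₁; inj₂)
open import Data.Vec using (Vec; []; _∷_; _++_; lookup; tabulate; replicate; allFin; toList)
open import Data.Vec.Properties using (lookup∘tabulate; tabulate-cong; tabulate∘lookup; lookup-map)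
open import Function.Bundles using (_⤖_; Bijection; Equivalence; mk↔ₛ′)
open import Function.Properties.Inverse using (↔⇒⤖)
open import Relation.Binary.Definitions using (tri<; tri≈; tri>)
open import Relation.Binary.PropositionalEquality
open import Relation.Nullary using (¬_; Dec; yes; no)

∧-split : ∀ {a b} → a ∧ b ≡ true → a ≡ true × b ≡ true
∧-split {true} {true} _ = refl , refl

∧-intro : ∀ {a b} → a ≡ true → b ≡ true → a ∧ b ≡ true
∧-intro refl refl = refl

∧≡false : ∀ {a b} → (a ≡ false) ⊎ (b ≡ false) → a ∧ b ≡ false
∧≡false {false} _ = refl
∧≡false {true} {false} _ = refl
∧≡false {true} {true} (inj₁ ())
∧≡false {true} {true} (inj₂ ())

and3-false : ∀ {a b c} → (a ≡ true → b ≡ true → c ≡ true → ⊥) → (a ∧ (b ∧ c)) ≡ false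
and3-false {false} h = refl
and3-false {true} {false} h = refl
and3-false {true} {true} {false} h = refl
and3-false {true} {true} {true} h = ⊥-elim (h refl refl refl)

≡true-⇔ : ∀ {a b : Bool} → (a ≡ true → b ≡ true) → (b ≡ true → a ≡ true) → a ≡ b
≡true-⇔ {true} {true} f g = refl
≡true-⇔ {true} {false} f g = sym (f refl)
≡true-⇔ {false} {true} f g = g refl
≡true-⇔ {false} {false} f g = refl

false≢true : ∀ {a} → a ≡ false → a ≡ true → ⊥
false≢true refl ()

T⇒≡true : ∀ {b} → T b → b ≡ true
T⇒≡true = Equivalence.to T-≡

≡true⇒T : ∀ {b} → b ≡ true → T b
≡true⇒T = Equivalence.from T-≡

≤ᵇ-true : ∀ {m n} → m ≤ n → (m ≤ᵇ n) ≡ true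
≤ᵇ-true p = T⇒≡true (≤⇒≤ᵇ p)

≤ᵇ-sound : ∀ {m n} → (m ≤ᵇ n) ≡ true → m ≤ n
≤ᵇ-sound {m} {n} h = ≤ᵇ⇒≤ m n (≡true⇒T h)

≤ᵇ-false : ∀ {m n} → ¬ (m ≤ n) → (m ≤ᵇ n) ≡ false
≤ᵇ-false {m} {n} ¬p with m ≤ᵇ n in eq
... | true = ⊥-elim (¬p (≤ᵇ-sound eq))
... | false = refl

<ᵇ-true : ∀ {m n} → m < n → (m <ᵇ n) ≡ true
<ᵇ-true p = T⇒≡true (<⇒<ᵇ p)

<ᵇ-sound : ∀ {m n} → (m <ᵇ n) ≡ true → m < n
<ᵇ-sound {m} {n} h = <ᵇ⇒< m n (≡true⇒T h)

<ᵇ-false : ∀ {m n} → ¬ (m < n) → (m <ᵇ n) ≡ false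
<ᵇ-false {m} {n} ¬p with m <ᵇ n in eq
... | true = ⊥-elim (¬p (<ᵇ-sound eq))
... | false = refl

≡ᵇ-true : ∀ {m n} → m ≡ n → (m ≡ᵇ n) ≡ true
≡ᵇ-true {m} {n} p = T⇒≡true (≡⇒≡ᵇ m n p)

≡ᵇ-sound : ∀ {m n} → (m ≡ᵇ n) ≡ true → m ≡ n
≡ᵇ-sound {m} {n} h = ≡ᵇ⇒≡ m n (≡true⇒T h)

≡ᵇ-false : ∀ {m n} → m ≢ n → (m ≡ᵇ n) ≡ false
≡ᵇ-false {m} {n} ¬p with m ≡ᵇ n in eq
... | true = ⊥-elim (¬p (≡ᵇ-sound eq))
... | false = refl

≤ᵇ≡not-<ᵇ : ∀ m n → (m ≤ᵇ n) ≡ not (n <ᵇ m)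
≤ᵇ≡not-<ᵇ m n with n <? m
... | yes p = trans (≤ᵇ-false (<⇒≱ p)) (sym (cong not (<ᵇ-true p)))
... | no p = trans (≤ᵇ-true (≮⇒≥ p)) (sym (cong not (<ᵇ-false p)))

<ᵇ≡not-≤ᵇ : ∀ m n → (m <ᵇ n) ≡ not (n ≤ᵇ m)
<ᵇ≡not-≤ᵇ m n with m <? n
... | yes p = trans (<ᵇ-true p) (sym (cong not (≤ᵇ-false (<⇒≱ p))))
... | no p = trans (<ᵇ-false p) (sym (cong not (≤ᵇ-true (≮⇒≥ p))))

Σ-T-≡ : ∀ {A : Set} (P : A → Bool) {a a′ : A} {x : T (P a)} {y : T (P a′)} →
        a ≡ a′ → _≡_ {A = Σ A (λ z → T (P z))} (a , x) (a′ , y)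
Σ-T-≡ P {a} refl = cong (a ,_) (T-irrelevant _ _)

all-applyUpTo⁻ : ∀ {A : Set} (p : A → Bool) (f : ℕ → A) m →
  all p (applyUpTo f m) ≡ true → ∀ k → k < m → p (f k) ≡ true
all-applyUpTo⁻ p f (suc m) h zero k<m with p (f 0) | h
... | true | _ = refl
all-applyUpTo⁻ p f (suc m) h (suc k) (s≤s k<m) with p (f 0) | h
... | true | h′ = all-applyUpTo⁻ p (λ t → f (suc t)) m h′ k k<m

all-applyUpTo⁺ : ∀ {A : Set} (p : A → Bool) (f : ℕ → A) m →
  (∀ k → k < m → p (f k) ≡ true) → all p (applyUpTo f m) ≡ true
all-applyUpTo⁺ p f zero h = refl
all-applyUpTo⁺ p f (suc m) h rewrite h 0 (s≤s z≤n) =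
  all-applyUpTo⁺ p (λ t → f (suc t)) m (λ k k<m → h (suc k) (s≤s k<m))

all-applyUpTo-false : ∀ {A : Set} (p : A → Bool) (f : ℕ → A) m k →
  k < m → p (f k) ≡ false → all p (applyUpTo f m) ≡ false
all-applyUpTo-false p f m k k<m h with all p (applyUpTo f m) in eq
... | true = ⊥-elim (false≢true h (all-applyUpTo⁻ p f m eq k k<m))
... | false = refl

all-tabulate⁻ : ∀ {A : Set} {m} (p : A → Bool) (f : Fin m → A) →
  all p (toList (tabulate f)) ≡ true → ∀ i → p (f i) ≡ true
all-tabulate⁻ {m = suc m} p f h fzero with p (f fzero) | h
... | true | _ = refl
all-tabulate⁻ {m = suc m} p f h (fsuc i) with p (f fzero) | h
... | true | h′ = all-tabulate⁻ p (λ j → f (fsuc j)) h′ i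

all-tabulate⁺ : ∀ {A : Set} {m} (p : A → Bool) (f : Fin m → A) →
  (∀ i → p (f i) ≡ true) → all p (toList (tabulate f)) ≡ true
all-tabulate⁺ {m = zero} p f h = refl
all-tabulate⁺ {m = suc m} p f h rewrite h fzero = all-tabulate⁺ p (λ j → f (fsuc j)) (λ i → h (fsuc i))

all-cong : ∀ {A : Set} (p r : A → Bool) (xs : List A) → (∀ x → p x ≡ r x) → all p xs ≡ all r xs
all-cong p r List.[] h = refl
all-cong p r (x List.∷ xs) h = cong₂ _∧_ (h x) (all-cong p r xs h)

bool→ℕ : Bool → ℕ
bool→ℕ true = 1
bool→ℕ false = 0

count : ℕ → (ℕ → Bool) → ℕ
count zero q = 0
count (suc m) q = bool→ℕ (q 0) + count m (λ t → q (suc t))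

countTrue-∷ : ∀ b bs → countTrue (b List.∷ bs) ≡ bool→ℕ b + countTrue bs
countTrue-∷ true bs = refl
countTrue-∷ false bs = refl

countTrue-tabulate : ∀ {A : Set} m (f : Fin m → A) (p : A → Bool) (q : ℕ → Bool) →
  (∀ i → p (f i) ≡ q (toℕ i)) → countTrue (toList (Data.Vec.map p (tabulate f))) ≡ count m q
countTrue-tabulate zero f p q h = refl
countTrue-tabulate (suc m) f p q h =
  trans (countTrue-∷ (p (f fzero)) _)
        (cong₂ _+_ (cong bool→ℕ (h fzero))
                   (countTrue-tabulate m (λ i → f (fsuc i)) p (λ t → q (suc t)) (λ i → h (fsuc i))))

countFin≡count : ∀ m (p : Fin m → Bool) (q : ℕ → Bool) → (∀ i → p i ≡ q (toℕ i)) → countFin p ≡ count m q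
countFin≡count m p q h = countTrue-tabulate m (λ i → i) p q h

count-cong : ∀ m (q r : ℕ → Bool) → (∀ t → t < m → q t ≡ r t) → count m q ≡ count m r
count-cong zero q r h = refl
count-cong (suc m) q r h =
  cong₂ _+_ (cong bool→ℕ (h 0 (s≤s z≤n))) (count-cong m _ _ (λ t t<m → h (suc t) (s≤s t<m)))

count-+ : ∀ a b (q : ℕ → Bool) → count (a + b) q ≡ count a q + count b (λ t → q (a + t))
count-+ zero b q = refl
count-+ (suc a) b q =
  trans (cong (bool→ℕ (q 0) +_) (count-+ a b (λ t → q (suc t)))) (sym (+-assoc (bool→ℕ (q 0)) _ _))

count-none : ∀ m (q : ℕ → Bool) → (∀ t → t < m → q t ≡ false) → count m q ≡ 0
count-none m q h = trans (count-cong m q (λ _ → false) h) (count-false m)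
  where
  count-false : ∀ m → count m (λ _ → false) ≡ 0
  count-false zero = refl
  count-false (suc m) = count-false m

count-snoc : ∀ t (q : ℕ → Bool) → count (suc t) q ≡ count t q + bool→ℕ (q t)
count-snoc zero q = +-identityʳ _
count-snoc (suc t) q =
  trans (cong (bool→ℕ (q 0) +_) (count-snoc t (λ s → q (suc s)))) (sym (+-assoc (bool→ℕ (q 0)) _ _))

count-mono : ∀ t (q r : ℕ → Bool) → (∀ s → s < t → q s ≡ true → r s ≡ true) → count t q ≤ count t r
count-mono zero q r h = z≤n
count-mono (suc t) q r h = +-mono-≤ (bool→ℕ-mono (h 0 (s≤s z≤n))) (count-mono t _ _ (λ s p → h (suc s) (s≤s p)))
  where
  bool→ℕ-mono : ∀ {a b} → (a ≡ true → b ≡ true) → bool→ℕ a ≤ bool→ℕ b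
  bool→ℕ-mono {false} h = z≤n
  bool→ℕ-mono {true} h rewrite h refl = ≤-refl

count-pos : ∀ t (q : ℕ → Bool) s → s < t → q s ≡ true → 1 ≤ count t q
count-pos (suc t) q zero _ h rewrite h = s≤s z≤n
count-pos (suc t) q (suc s) (s≤s p) h = ≤-trans (count-pos t (λ s → q (suc s)) s p h) (m≤n+m _ (bool→ℕ (q 0)))

count-one-more : ∀ t (q r : ℕ → Bool) s → s < t → q s ≡ true → r s ≡ false →
  (∀ s′ → s′ < t → s′ ≢ s → q s′ ≡ r s′) → count t q ≡ suc (count t r)
count-one-more (suc t) q r zero _ hq hr h rewrite hq | hr =
  cong suc (count-cong t _ _ (λ s p → h (suc s) (s≤s p) (λ ())))
count-one-more (suc t) q r (suc s) (s≤s p) hq hr h rewrite h 0 (s≤s z≤n) (λ ()) =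
  trans (cong (bool→ℕ (r 0) +_)
          (count-one-more t _ _ s p hq hr (λ s′ p′ ne → h (suc s′) (s≤s p′) (λ e → ne (suc-injective e)))))
        (+-suc (bool→ℕ (r 0)) _)

iter-+ : ∀ {A : Set} (f : A → A) a b x → iter f (a + b) x ≡ iter f a (iter f b x)
iter-+ f zero b x = refl
iter-+ f (suc a) b x = cong f (iter-+ f a b x)

iter-natural : ∀ {A B : Set} (f : A → A) (g : B → B) (h : A → B) →
  (∀ x → h (f x) ≡ g (h x)) → ∀ k x → h (iter f k x) ≡ iter g k (h x)
iter-natural f g h c zero x = refl
iter-natural f g h c (suc k) x = trans (c _) (cong g (iter-natural f g h c k x))

lookupℕ : ∀ {A : Set} {K} → A → Vec A K → ℕ → A
lookupℕ d [] t = d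
lookupℕ d (x ∷ xs) zero = x
lookupℕ d (x ∷ xs) (suc t) = lookupℕ d xs t

lookup≡lookupℕ : ∀ {A : Set} {K} (d : A) (v : Vec A K) (i : Fin K) → lookup v i ≡ lookupℕ d v (toℕ i)
lookup≡lookupℕ d (x ∷ v) fzero = refl
lookup≡lookupℕ d (x ∷ v) (fsuc i) = lookup≡lookupℕ d v i

lookupℕ-++ˡ : ∀ {A : Set} {K L} (d : A) (xs : Vec A K) (ys : Vec A L) t → t < K →
              lookupℕ d (xs ++ ys) t ≡ lookupℕ d xs t
lookupℕ-++ˡ d (x ∷ xs) ys zero _ = refl
lookupℕ-++ˡ d (x ∷ xs) ys (suc t) (s≤s p) = lookupℕ-++ˡ d xs ys t p

lookupℕ-++ʳ : ∀ {A : Set} {K L} (d : A) (xs : Vec A K) (ys : Vec A L) t →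
              lookupℕ d (xs ++ ys) (K + t) ≡ lookupℕ d ys t
lookupℕ-++ʳ d [] ys t = refl
lookupℕ-++ʳ d (x ∷ xs) ys t = lookupℕ-++ʳ d xs ys t

m∸n≡1+m∸1+n : ∀ m n → n < m → m ∸ n ≡ suc (m ∸ suc n)
m∸n≡1+m∸1+n m n = +-∸-assoc 1

+≡+⇒≤ : ∀ {a b c d} → a + b ≡ c + d → c ≤ a → b ≤ d
+≡+⇒≤ {a} {b} {c} {d} e p = +-cancelˡ-≤ c b d (subst (c + b ≤_) e (+-monoˡ-≤ b p))

+≡+⇒< : ∀ {a b c d} → a + b ≡ c + d → c < a → b < d
+≡+⇒< {a} {b} {c} {d} e p =
  +-cancelˡ-≤ c (suc b) d (subst (_≤ c + d) (sym (+-suc c b)) (subst (suc c + b ≤_) e (+-monoˡ-≤ b p)))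

double-+ : ∀ a b → (a + b) + (a + b) ≡ (a + a) + (b + b)
double-+ a b = begin
  (a + b) + (a + b) ≡⟨ +-assoc a b (a + b) ⟩
  a + (b + (a + b)) ≡⟨ cong (a +_) (sym (+-assoc b a b)) ⟩
  a + ((b + a) + b) ≡⟨ cong (λ x → a + (x + b)) (+-comm b a) ⟩
  a + ((a + b) + b) ≡⟨ cong (a +_) (+-assoc a b b) ⟩
  a + (a + (b + b)) ≡⟨ sym (+-assoc a a (b + b)) ⟩
  (a + a) + (b + b) ∎
  where open ≡-Reasoning

double-cancel-≤ : ∀ {x y} → x + x ≤ y + y → x ≤ y
double-cancel-≤ {x} {y} p with x ≤? y
... | yes q = q
... | no q = ⊥-elim (<⇒≱ (+-mono-< (≰⇒> q) (≰⇒> q)) p)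

double≤1+double⇒≤ : ∀ {x y} → x + x ≤ suc (y + y) → x ≤ y
double≤1+double⇒≤ {x} {y} p with x ≤? y
... | yes q = q
... | no q = ⊥-elim (<⇒≱ (subst (_≤ x + x) (cong suc (+-suc y y)) (+-mono-≤ (≰⇒> q) (≰⇒> q))) p)

double-cancel-< : ∀ {x y} → x + x < y + y → x < y
double-cancel-< {x} {y} p with x <? y
... | yes q = q
... | no q = ⊥-elim (<⇒≱ p (+-mono-≤ (≮⇒≥ q) (≮⇒≥ q)))

double-injective : ∀ {x y} → x + x ≡ y + y → x ≡ y
double-injective e = ≤-antisym (double-cancel-≤ (≤-reflexive e)) (double-cancel-≤ (≤-reflexive (sym e)))

data Halving : ℕ → Set where
  twice : ∀ c → Halving (c + c)
  twice+1 : ∀ c → Halving (suc (c + c))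

halving : ∀ j → Halving j
halving zero = twice 0
halving (suc j) with halving j
... | twice c = twice+1 c
... | twice+1 c = subst Halving (cong suc (+-suc c c)) (twice (suc c))

⌊double/2⌋ : ∀ c → ⌊ c + c /2⌋ ≡ c
⌊double/2⌋ zero = refl
⌊double/2⌋ (suc c) rewrite +-suc c c = cong suc (⌊double/2⌋ c)

⌊1+double/2⌋ : ∀ c → ⌊ suc (c + c) /2⌋ ≡ c
⌊1+double/2⌋ zero = refl
⌊1+double/2⌋ (suc c) rewrite +-suc c c = cong suc (⌊1+double/2⌋ c)

even-double : ∀ c → even (c + c) ≡ true
even-double zero = refl
even-double (suc c) rewrite +-suc c c | not-involutive (even (c + c)) = even-double c

even-1+double : ∀ c → even (suc (c + c)) ≡ false
even-1+double c rewrite even-double c = refl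

even-+-same : ∀ {a a′} → a′ ≡ a → even (a + a′) ≡ true
even-+-same {a} refl = even-double a

even-+-suc : ∀ {a a′} → a′ ≡ suc a → even (a + a′) ≡ false
even-+-suc {a} refl rewrite +-suc a a = even-1+double a

even-+-double : ∀ a c → even (a + (c + c)) ≡ even a
even-+-double zero c = even-double c
even-+-double (suc a) c = cong not (even-+-double a c)

double≤⇒≤⌊/2⌋ : ∀ x j → x + x ≤ j → x ≤ ⌊ j /2⌋
double≤⇒≤⌊/2⌋ x j p with halving j
... | twice c rewrite ⌊double/2⌋ c = double-cancel-≤ p
... | twice+1 c rewrite ⌊1+double/2⌋ c = double≤1+double⇒≤ p

<double⇒⌊/2⌋< : ∀ y j → j < y + y → ⌊ j /2⌋ < y
<double⇒⌊/2⌋< y j p with halving j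
... | twice c rewrite ⌊double/2⌋ c = double-cancel-< p
... | twice+1 c rewrite ⌊1+double/2⌋ c = double-cancel-< (<-trans (n<1+n (c + c)) p)

≤⌊/2⌋⇒double≤ : ∀ x j → x ≤ ⌊ j /2⌋ → x + x ≤ j
≤⌊/2⌋⇒double≤ x j p with halving j
... | twice c rewrite ⌊double/2⌋ c = +-mono-≤ p p
... | twice+1 c rewrite ⌊1+double/2⌋ c = m≤n⇒m≤1+n (+-mono-≤ p p)

⌊/2⌋<⇒<double : ∀ y j → ⌊ j /2⌋ < y → j < y + y
⌊/2⌋<⇒<double y j p with halving j
... | twice c rewrite ⌊double/2⌋ c = +-mono-< p p
... | twice+1 c rewrite ⌊1+double/2⌋ c = subst (_≤ y + y) (cong suc (+-suc c c)) (+-mono-≤ p p)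

≤1+double⇒⌊/2⌋≤ : ∀ {j k} → j ≤ suc (k + k) → ⌊ j /2⌋ ≤ k
≤1+double⇒⌊/2⌋≤ {j} {k} p = s≤s⁻¹ (<double⇒⌊/2⌋< (suc k) j (subst (j <_) (sym (cong suc (+-suc k k))) (s≤s p)))

⌊a+a′/2⌋ : ∀ a a′ → (a′ ≡ a) ⊎ (a′ ≡ suc a) → ⌊ a + a′ /2⌋ ≡ a
⌊a+a′/2⌋ a a′ (inj₁ refl) = ⌊double/2⌋ a
⌊a+a′/2⌋ a a′ (inj₂ refl) rewrite +-suc a a = ⌊1+double/2⌋ a

⌊/2⌋-parity-injective : ∀ x y → ⌊ x /2⌋ ≡ ⌊ y /2⌋ → even x ≡ even y → x ≡ y
⌊/2⌋-parity-injective x y h e with halving x | halving y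
... | twice c | twice d rewrite ⌊double/2⌋ c | ⌊double/2⌋ d | h = refl
... | twice+1 c | twice+1 d rewrite ⌊1+double/2⌋ c | ⌊1+double/2⌋ d | h = refl
... | twice c | twice+1 d rewrite even-double c | even-1+double d with e
...   | ()
⌊/2⌋-parity-injective x y h e | twice+1 c | twice d rewrite even-1+double c | even-double d with e
...   | ()

-- Beyond the end of a word, stepAt is a junk E while xAt and yAt stay at the endpoint.
stepAt : ∀ {m} → Vec Step m → ℕ → Step
stepAt [] t = E
stepAt (s ∷ w) zero = s
stepAt (s ∷ w) (suc t) = stepAt w t

xAt : ∀ {m} → Vec Step m → ℕ → ℕ
xAt [] t = 0
xAt (s ∷ w) zero = 0
xAt (N ∷ w) (suc t) = xAt w t
xAt (E ∷ w) (suc t) = suc (xAt w t)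

yAt : ∀ {m} → Vec Step m → ℕ → ℕ
yAt [] t = 0
yAt (s ∷ w) zero = 0
yAt (N ∷ w) (suc t) = suc (yAt w t)
yAt (E ∷ w) (suc t) = yAt w t

xAt-0 : ∀ {m} (w : Vec Step m) → xAt w 0 ≡ 0
xAt-0 [] = refl
xAt-0 (s ∷ w) = refl

yAt-0 : ∀ {m} (w : Vec Step m) → yAt w 0 ≡ 0
yAt-0 [] = refl
yAt-0 (s ∷ w) = refl

step-cases : ∀ (s : Step) → (s ≡ N) ⊎ (s ≡ E)
step-cases N = inj₁ refl
step-cases E = inj₂ refl

N≢E : N ≡ E → ⊥
N≢E ()

stepAt-lookup : ∀ {m} (w : Vec Step m) (i : Fin m) → stepAt w (toℕ i) ≡ lookup w i
stepAt-lookup (x ∷ w) fzero = refl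
stepAt-lookup (x ∷ w) (fsuc i) = stepAt-lookup w i

stepAt-tab : ∀ {m} (g : Fin m → Step) (G : ℕ → Step) → (∀ i → g i ≡ G (toℕ i)) →
             ∀ t → t < m → stepAt (tabulate g) t ≡ G t
stepAt-tab {suc m} g G h zero _ = h fzero
stepAt-tab {suc m} g G h (suc t) (s≤s p) = stepAt-tab (λ i → g (fsuc i)) (λ s → G (suc s)) (λ i → h (fsuc i)) t p

xAt+yAt : ∀ {m} (w : Vec Step m) t → t ≤ m → xAt w t + yAt w t ≡ t
xAt+yAt [] zero _ = refl
xAt+yAt (s ∷ w) zero _ = refl
xAt+yAt (N ∷ w) (suc t) (s≤s p) = trans (+-suc (xAt w t) (yAt w t)) (cong suc (xAt+yAt w t p))
xAt+yAt (E ∷ w) (suc t) (s≤s p) = cong suc (xAt+yAt w t p)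

xAt-end : ∀ {m} (w : Vec Step m) t → m ≤ t → xAt w t ≡ xAt w m
xAt-end [] t _ = refl
xAt-end (N ∷ w) (suc t) (s≤s p) = xAt-end w t p
xAt-end (E ∷ w) (suc t) (s≤s p) = cong suc (xAt-end w t p)

yAt-end : ∀ {m} (w : Vec Step m) t → m ≤ t → yAt w t ≡ yAt w m
yAt-end [] t _ = refl
yAt-end (N ∷ w) (suc t) (s≤s p) = cong suc (yAt-end w t p)
yAt-end (E ∷ w) (suc t) (s≤s p) = yAt-end w t p

xAt-N : ∀ {m} (w : Vec Step m) t → t < m → stepAt w t ≡ N → xAt w (suc t) ≡ xAt w t
xAt-N (N ∷ w) zero _ _ = xAt-0 w
xAt-N (N ∷ w) (suc t) (s≤s p) q = xAt-N w t p q
xAt-N (E ∷ w) (suc t) (s≤s p) q = cong suc (xAt-N w t p q)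

xAt-E : ∀ {m} (w : Vec Step m) t → t < m → stepAt w t ≡ E → xAt w (suc t) ≡ suc (xAt w t)
xAt-E (E ∷ w) zero _ _ = cong suc (xAt-0 w)
xAt-E (N ∷ w) (suc t) (s≤s p) q = xAt-E w t p q
xAt-E (E ∷ w) (suc t) (s≤s p) q = cong suc (xAt-E w t p q)

yAt-N : ∀ {m} (w : Vec Step m) t → t < m → stepAt w t ≡ N → yAt w (suc t) ≡ suc (yAt w t)
yAt-N (N ∷ w) zero _ _ = cong suc (yAt-0 w)
yAt-N (N ∷ w) (suc t) (s≤s p) q = cong suc (yAt-N w t p q)
yAt-N (E ∷ w) (suc t) (s≤s p) q = yAt-N w t p q

yAt-E : ∀ {m} (w : Vec Step m) t → t < m → stepAt w t ≡ E → yAt w (suc t) ≡ yAt w t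
yAt-E (E ∷ w) zero _ _ = yAt-0 w
yAt-E (N ∷ w) (suc t) (s≤s p) q = cong suc (yAt-E w t p q)
yAt-E (E ∷ w) (suc t) (s≤s p) q = yAt-E w t p q

xAt-≤-suc : ∀ {m} (w : Vec Step m) t → xAt w t ≤ xAt w (suc t)
xAt-≤-suc [] t = z≤n
xAt-≤-suc (s ∷ w) zero = z≤n
xAt-≤-suc (N ∷ w) (suc t) = xAt-≤-suc w t
xAt-≤-suc (E ∷ w) (suc t) = s≤s (xAt-≤-suc w t)

xAt-suc-≤ : ∀ {m} (w : Vec Step m) t → xAt w (suc t) ≤ suc (xAt w t)
xAt-suc-≤ [] t = z≤n
xAt-suc-≤ (N ∷ w) zero rewrite xAt-0 w = z≤n
xAt-suc-≤ (E ∷ w) zero rewrite xAt-0 w = s≤s z≤n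
xAt-suc-≤ (N ∷ w) (suc t) = xAt-suc-≤ w t
xAt-suc-≤ (E ∷ w) (suc t) = s≤s (xAt-suc-≤ w t)

yAt-≤-suc : ∀ {m} (w : Vec Step m) t → yAt w t ≤ yAt w (suc t)
yAt-≤-suc [] t = z≤n
yAt-≤-suc (s ∷ w) zero = z≤n
yAt-≤-suc (N ∷ w) (suc t) = s≤s (yAt-≤-suc w t)
yAt-≤-suc (E ∷ w) (suc t) = yAt-≤-suc w t

yAt-suc-≤ : ∀ {m} (w : Vec Step m) t → yAt w (suc t) ≤ suc (yAt w t)
yAt-suc-≤ [] t = z≤n
yAt-suc-≤ (N ∷ w) zero rewrite yAt-0 w = s≤s z≤n
yAt-suc-≤ (E ∷ w) zero rewrite yAt-0 w = z≤n
yAt-suc-≤ (N ∷ w) (suc t) = s≤s (yAt-suc-≤ w t)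
yAt-suc-≤ (E ∷ w) (suc t) = yAt-suc-≤ w t

yAt-mono : ∀ {m} (w : Vec Step m) {s t} → s ≤ t → yAt w s ≤ yAt w t
yAt-mono w {s} {t} p with m≤n⇒∃[o]m+o≡n p
... | o , refl = go o
  where
  go : ∀ o → yAt w s ≤ yAt w (s + o)
  go zero rewrite +-identityʳ s = ≤-refl
  go (suc o) rewrite +-suc s o = ≤-trans (go o) (yAt-≤-suc w (s + o))

yAt≤yAt-end : ∀ {m} (w : Vec Step m) s → yAt w s ≤ yAt w m
yAt≤yAt-end {m} w s with s ≤? m
... | yes p = yAt-mono w p
... | no p = ≤-reflexive (yAt-end w s (<⇒≤ (≰⇒> p)))

xAt-suc-cases : ∀ {m} (w : Vec Step m) t → (xAt w (suc t) ≡ xAt w t) ⊎ (xAt w (suc t) ≡ suc (xAt w t))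
xAt-suc-cases w t with m≤n⇒m<n∨m≡n (xAt-suc-≤ w t)
... | inj₂ e = inj₂ e
... | inj₁ l = inj₁ (≤-antisym (s≤s⁻¹ l) (xAt-≤-suc w t))

yAt-suc-cases : ∀ {m} (w : Vec Step m) t → (yAt w (suc t) ≡ yAt w t) ⊎ (yAt w (suc t) ≡ suc (yAt w t))
yAt-suc-cases w t with m≤n⇒m<n∨m≡n (yAt-suc-≤ w t)
... | inj₂ e = inj₂ e
... | inj₁ l = inj₁ (≤-antisym (s≤s⁻¹ l) (yAt-≤-suc w t))

xAt≤t : ∀ {m} (w : Vec Step m) t → xAt w t ≤ t
xAt≤t [] t = z≤n
xAt≤t (s ∷ w) zero = z≤n
xAt≤t (N ∷ w) (suc t) = m≤n⇒m≤1+n (xAt≤t w t)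
xAt≤t (E ∷ w) (suc t) = s≤s (xAt≤t w t)

yAt≤t : ∀ {m} (w : Vec Step m) t → yAt w t ≤ t
yAt≤t [] t = z≤n
yAt≤t (s ∷ w) zero = z≤n
yAt≤t (N ∷ w) (suc t) = s≤s (yAt≤t w t)
yAt≤t (E ∷ w) (suc t) = m≤n⇒m≤1+n (yAt≤t w t)

xAt-negPath : ∀ {m} (w : Vec Step m) t → xAt (negPath w) t ≡ yAt w t
xAt-negPath [] t = refl
xAt-negPath (s ∷ w) zero = refl
xAt-negPath (N ∷ w) (suc t) = cong suc (xAt-negPath w t)
xAt-negPath (E ∷ w) (suc t) = xAt-negPath w t

dyck⇒x≤c+y : ∀ {m} (w : Vec Step m) c → dyckFrom c w ≡ true → ∀ t → xAt w t ≤ c + yAt w t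
dyck⇒x≤c+y [] c h t = z≤n
dyck⇒x≤c+y (s ∷ w) c h zero = z≤n
dyck⇒x≤c+y (N ∷ w) c h (suc t) rewrite +-suc c (yAt w t) = dyck⇒x≤c+y w (suc c) h t
dyck⇒x≤c+y (E ∷ w) zero () (suc t)
dyck⇒x≤c+y (E ∷ w) (suc c) h (suc t) = s≤s (dyck⇒x≤c+y w c h t)

dyck⇒x≡c+y : ∀ {m} (w : Vec Step m) c → dyckFrom c w ≡ true → xAt w m ≡ c + yAt w m
dyck⇒x≡c+y [] c h = sym (trans (+-identityʳ c) (≡ᵇ-sound h))
dyck⇒x≡c+y (N ∷ w) c h = trans (dyck⇒x≡c+y w (suc c) h) (sym (+-suc c (yAt w _)))
dyck⇒x≡c+y (E ∷ w) zero ()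
dyck⇒x≡c+y (E ∷ w) (suc c) h = cong suc (dyck⇒x≡c+y w c h)

dyck-intro : ∀ {m} (w : Vec Step m) c → (∀ t → t ≤ m → xAt w t ≤ c + yAt w t) → xAt w m ≡ c + yAt w m →
             dyckFrom c w ≡ true
dyck-intro [] c h e = ≡ᵇ-true (sym (trans e (+-identityʳ c)))
dyck-intro (N ∷ w) c h e = dyck-intro w (suc c)
  (λ t p → subst (xAt w t ≤_) (+-suc c (yAt w t)) (h (suc t) (s≤s p)))
  (trans e (+-suc c (yAt w _)))
dyck-intro (E ∷ w) zero h e = ⊥-elim (1+n≰n (subst₂ (λ a b → suc a ≤ b) (xAt-0 w) (yAt-0 w) (h 1 (s≤s z≤n))))
dyck-intro (E ∷ w) (suc c) h e = dyck-intro w c (λ t p → s≤s⁻¹ (h (suc t) (s≤s p))) (suc-injective e)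

heightOfEStep-≥ : ∀ {m} (w : Vec Step m) y a → a < xAt w m → y ≤ heightOfEStep y a w
heightOfEStep-≥ [] y a ()
heightOfEStep-≥ (N ∷ w) y a p = ≤-trans (n≤1+n y) (heightOfEStep-≥ w (suc y) a p)
heightOfEStep-≥ (E ∷ w) y zero p = ≤-refl
heightOfEStep-≥ (E ∷ w) y (suc a) (s≤s p) = heightOfEStep-≥ w y a p

heightOfEStep-beyond : ∀ {m} (w : Vec Step m) y a → xAt w m ≤ a → heightOfEStep y a w ≡ 0
heightOfEStep-beyond [] y a p = refl
heightOfEStep-beyond (N ∷ w) y a p = heightOfEStep-beyond w (suc y) a p
heightOfEStep-beyond (E ∷ w) y zero ()
heightOfEStep-beyond (E ∷ w) y (suc a) (s≤s p) = heightOfEStep-beyond w y a p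

-- The (a + 1)-th E step of w, read from height y, is its step number a + (heightOfEStep y a w ∸ y).
xAt≤⇔≤heightOfEStep : ∀ {m} (w : Vec Step m) y a → a < xAt w m → ∀ s → s ≤ m →
     (xAt w s ≤ a → y + s ≤ a + heightOfEStep y a w) × (y + s ≤ a + heightOfEStep y a w → xAt w s ≤ a)
xAt≤⇔≤heightOfEStep [] y a () s q
xAt≤⇔≤heightOfEStep (N ∷ w) y a p zero q =
  (λ _ → subst (_≤ a + heightOfEStep (suc y) a w) (sym (+-identityʳ y))
           (≤-trans (≤-trans (n≤1+n y) (heightOfEStep-≥ w (suc y) a p)) (m≤n+m _ a))) , (λ _ → z≤n)
xAt≤⇔≤heightOfEStep (N ∷ w) y a p (suc s) (s≤s q) with xAt≤⇔≤heightOfEStep w (suc y) a p s q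
... | f , g = (λ h → subst (_≤ a + heightOfEStep (suc y) a w) (sym (+-suc y s)) (f h))
            , (λ h → g (subst (_≤ a + heightOfEStep (suc y) a w) (+-suc y s) h))
xAt≤⇔≤heightOfEStep (E ∷ w) y zero p zero q = (λ _ → ≤-reflexive (+-identityʳ y)) , (λ _ → z≤n)
xAt≤⇔≤heightOfEStep (E ∷ w) y zero p (suc s) q = (λ ()) , (λ h → ⊥-elim (<⇒≱ (m<m+n y {suc s} (s≤s z≤n)) h))
xAt≤⇔≤heightOfEStep (E ∷ w) y (suc a) (s≤s p) zero q =
  (λ _ → subst (_≤ suc a + heightOfEStep y a w) (sym (+-identityʳ y))
           (≤-trans (heightOfEStep-≥ w y a p) (m≤n+m _ (suc a)))) , (λ _ → z≤n)
xAt≤⇔≤heightOfEStep (E ∷ w) y (suc a) (s≤s p) (suc s) (s≤s q) with xAt≤⇔≤heightOfEStep w y a p s q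
... | f , g = (λ { (s≤s h) → subst (_≤ suc (a + heightOfEStep y a w)) (sym (+-suc y s)) (s≤s (f h)) })
            , (λ h → s≤s (g (s≤s⁻¹ (subst (_≤ suc (a + heightOfEStep y a w)) (+-suc y s) h))))

<heightOfEStep : ∀ {m} (w : Vec Step m) a b → a < xAt w m →
        (b <ᵇ heightOfEStep 0 a w) ≡ (xAt w (suc (a + b)) ≤ᵇ a)
<heightOfEStep {m} w a b p with suc (a + b) ≤? m
... | yes s≤m = ≡true-⇔
        (λ h → ≤ᵇ-true (proj₂ (xAt≤⇔≤heightOfEStep w 0 a p (suc (a + b)) s≤m)
                 (subst (_≤ a + heightOfEStep 0 a w) (+-suc a b) (+-monoʳ-≤ a (<ᵇ-sound h)))))
        (λ h → <ᵇ-true (+-cancelˡ-≤ a (suc b) _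
                 (subst (_≤ a + heightOfEStep 0 a w) (sym (+-suc a b))
                        (proj₁ (xAt≤⇔≤heightOfEStep w 0 a p (suc (a + b)) s≤m) (≤ᵇ-sound h)))))
... | no s≰m = ≡true-⇔
        (λ h → ⊥-elim (<⇒≱ (<ᵇ-sound h) (beyond-end (≰⇒> s≰m))))
        (λ h → ⊥-elim (<⇒≱ p (subst (_≤ a) (xAt-end w (suc (a + b)) (<⇒≤ (≰⇒> s≰m))) (≤ᵇ-sound h))))
  where
  beyond-end : m < suc (a + b) → heightOfEStep 0 a w ≤ b
  beyond-end m<s with m ≤? a + heightOfEStep 0 a w
  ... | yes q = ⊥-elim (<⇒≱ p (proj₂ (xAt≤⇔≤heightOfEStep w 0 a p m ≤-refl) q))
  ... | no q = +-cancelˡ-≤ a _ _ (≤-trans (<⇒≤ (≰⇒> q)) (s≤s⁻¹ m<s))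

searchUp : (ℕ → Bool) → ℕ → ℕ → ℕ
searchUp p a zero = a
searchUp p a (suc f) = if p a then a else searchUp p (suc a) f

record Found (p : ℕ → Bool) (lo r hi : ℕ) : Set where
  field
    lo≤r : lo ≤ r
    r≤hi : r ≤ hi
    holds : p r ≡ true
    first : ∀ t → lo ≤ t → t < r → p t ≡ false

searchUp-finds : ∀ p a f d → d ≤ f → p (a + d) ≡ true → Found p a (searchUp p a f) (a + d)
searchUp-finds p a zero zero _ h =
  record { lo≤r = ≤-refl ; r≤hi = m≤m+n a 0 ; holds = subst (λ x → p x ≡ true) (+-identityʳ a) h
         ; first = λ t a≤t t<a → ⊥-elim (<⇒≱ t<a a≤t) }
searchUp-finds p a (suc f) d d≤f h with p a in eq
... | true = record { lo≤r = ≤-refl ; r≤hi = m≤m+n a d ; holds = eq ; first = λ t a≤t t<a → ⊥-elim (<⇒≱ t<a a≤t) }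
... | false with d
...   | zero = ⊥-elim (false≢true eq (subst (λ x → p x ≡ true) (+-identityʳ a) h))
...   | suc d′ =
  record { lo≤r = ≤-trans (n≤1+n a) (Found.lo≤r F) ; r≤hi = subst (r ≤_) (sym (+-suc a d′)) (Found.r≤hi F)
         ; holds = Found.holds F ; first = first′ }
  where
  r : ℕ
  r = searchUp p (suc a) f
  F : Found p (suc a) r (suc a + d′)
  F = searchUp-finds p (suc a) f d′ (s≤s⁻¹ d≤f) (subst (λ x → p x ≡ true) (+-suc a d′) h)
  first′ : ∀ t → a ≤ t → t < r → p t ≡ false
  first′ t a≤t t<r with m≤n⇒m<n∨m≡n a≤t
  ... | inj₁ a<t = Found.first F t a<t t<r
  ... | inj₂ refl = eq

searchDown : (ℕ → Bool) → ℕ → ℕ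
searchDown p zero = zero
searchDown p (suc a) = if p (suc a) then suc a else searchDown p a

record FoundLast (p : ℕ → Bool) (r hi : ℕ) : Set where
  field
    r≤hi : r ≤ hi
    holds : p r ≡ true
    last : ∀ t → r < t → t ≤ hi → p t ≡ false

searchDown-finds : ∀ p a → p 0 ≡ true → FoundLast p (searchDown p a) a
searchDown-finds p zero h = record { r≤hi = z≤n ; holds = h ; last = λ t r<t t≤0 → ⊥-elim (<⇒≱ r<t t≤0) }
searchDown-finds p (suc a) h with p (suc a) in eq
... | true = record { r≤hi = ≤-refl ; holds = eq ; last = λ t r<t t≤a → ⊥-elim (<⇒≱ r<t t≤a) }
... | false = record { r≤hi = m≤n⇒m≤1+n (FoundLast.r≤hi F) ; holds = FoundLast.holds F ; last = last′ }
  where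
  F : FoundLast p (searchDown p a) a
  F = searchDown-finds p a h
  last′ : ∀ t → searchDown p a < t → t ≤ suc a → p t ≡ false
  last′ t r<t t≤sa with m≤n⇒m<n∨m≡n t≤sa
  ... | inj₁ t<sa = FoundLast.last F t r<t (s≤s⁻¹ t<sa)
  ... | inj₂ refl = eq

module DyckMatching {m} (w : Vec Step m) (dy : isDyck w ≡ true) where

  x≤y : ∀ t → xAt w t ≤ yAt w t
  x≤y t = dyck⇒x≤c+y w 0 dy t

  x≡y-end : xAt w m ≡ yAt w m
  x≡y-end = dyck⇒x≡c+y w 0 dy

  height : ℕ → ℕ
  height t = yAt w t ∸ xAt w t

  y≡height+x : ∀ t → yAt w t ≡ height t + xAt w t
  y≡height+x t = sym (m∸n+n≡m (x≤y t))

  height+2x : ∀ t → t ≤ m → height t + (xAt w t + xAt w t) ≡ t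
  height+2x t p = begin
    height t + (xAt w t + xAt w t)  ≡⟨ sym (+-assoc (height t) _ _) ⟩
    height t + xAt w t + xAt w t    ≡⟨ cong (_+ xAt w t) (sym (y≡height+x t)) ⟩
    yAt w t + xAt w t               ≡⟨ +-comm (yAt w t) _ ⟩
    xAt w t + yAt w t               ≡⟨ xAt+yAt w t p ⟩
    t                               ∎
    where open ≡-Reasoning

  height-0 : height 0 ≡ 0
  height-0 rewrite xAt-0 w | yAt-0 w = refl

  height-end : ∀ t → m ≤ t → height t ≡ 0
  height-end t p rewrite xAt-end w t p | yAt-end w t p | x≡y-end = n∸n≡0 (yAt w m)

  height-N : ∀ t → t < m → stepAt w t ≡ N → height (suc t) ≡ suc (height t)
  height-N t p q rewrite xAt-N w t p q | yAt-N w t p q = +-∸-assoc 1 (x≤y t)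

  height-E : ∀ t → t < m → stepAt w t ≡ E → height t ≡ suc (height (suc t))
  height-E t p q with x≤y (suc t)
  ... | le rewrite xAt-E w t p q | yAt-E w t p q = m∸n≡1+m∸1+n (yAt w t) (xAt w t) le


  height-drop : ∀ t → height t ≤ suc (height (suc t))
  height-drop t with t <? m
  ... | no t≮m rewrite height-end t (≮⇒≥ t≮m) = z≤n
  ... | yes t<m with step-cases (stepAt w t)
  ...   | inj₁ q rewrite height-N t t<m q = m≤n⇒m≤1+n (n≤1+n _)
  ...   | inj₂ q = ≤-reflexive (height-E t t<m q)

  height-rise : ∀ t → height (suc t) ≤ suc (height t)
  height-rise t with t <? m
  ... | no t≮m rewrite height-end (suc t) (≤-trans (≮⇒≥ t≮m) (n≤1+n t)) = z≤n
  ... | yes t<m with step-cases (stepAt w t)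
  ...   | inj₁ q = ≤-reflexive (height-N t t<m q)
  ...   | inj₂ q rewrite height-E t t<m q = m≤n⇒m≤1+n (n≤1+n _)

  record Arch (i j : ℕ) : Set where
    field
      i<j : i < j
      j<m : j < m
      level : height (suc j) ≡ height i
      above : ∀ t → i < t → t ≤ j → height i < height t

  arch-of-first-return : ∀ {i j} → i < j → j < m → height (suc j) ≤ height i →
                         (∀ t → i < t → t ≤ j → height i < height t) → Arch i j
  arch-of-first-return {i} {j} i<j j<m low above =
    record { i<j = i<j ; j<m = j<m ; level = ≤-antisym low high ; above = above }
    where
    high : height i ≤ height (suc j)
    high = s≤s⁻¹ (≤-trans (above j i<j ≤-refl) (height-drop j))

  arch-of-last-departure : ∀ {i j} → i < j → j < m → height i ≤ height (suc j) →
                           (∀ t → i < t → t ≤ j → height (suc j) < height t) → Arch i j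
  arch-of-last-departure {i} {j} i<j j<m high above =
    record { i<j = i<j ; j<m = j<m ; level = level ; above = λ t i<t t≤j → subst (_< height t) level (above t i<t t≤j) }
    where
    level : height (suc j) ≡ height i
    level = ≤-antisym (s≤s⁻¹ (≤-trans (above (suc i) ≤-refl i<j) (height-rise i))) high

  arch-opens-with-N : ∀ {i j} → Arch i j → stepAt w i ≡ N
  arch-opens-with-N {i} {j} A with step-cases (stepAt w i)
  ... | inj₁ q = q
  ... | inj₂ q = ⊥-elim (<⇒≱ (Arch.above A (suc i) ≤-refl (Arch.i<j A))
                              (≤-trans (n≤1+n _) (≤-reflexive (sym (height-E i (<-trans (Arch.i<j A) (Arch.j<m A)) q)))))

  arch-closes-with-E : ∀ {i j} → Arch i j → stepAt w j ≡ E
  arch-closes-with-E {i} {j} A with step-cases (stepAt w j)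
  ... | inj₂ q = q
  ... | inj₁ q = ⊥-elim (<⇒≱ (Arch.above A j (Arch.i<j A) ≤-refl)
                              (≤-trans (n≤1+n _) (≤-reflexive (trans (sym (height-N j (Arch.j<m A) q)) (Arch.level A)))))

  arch-unique-right : ∀ {i j j′} → Arch i j → Arch i j′ → j ≡ j′
  arch-unique-right {i} {j} {j′} A A′ with <-cmp j j′
  ... | tri≈ _ e _ = e
  ... | tri< j<j′ _ _ = ⊥-elim (<-irrefl (sym (Arch.level A)) (Arch.above A′ (suc j) (<-trans (Arch.i<j A) ≤-refl) j<j′))
  ... | tri> _ _ j′<j = ⊥-elim (<-irrefl (sym (Arch.level A′)) (Arch.above A (suc j′) (<-trans (Arch.i<j A′) ≤-refl) j′<j))

  arch-unique-left : ∀ {i i′ j} → Arch i j → Arch i′ j → i ≡ i′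
  arch-unique-left {i} {i′} A A′ with <-cmp i i′
  ... | tri≈ _ e _ = e
  ... | tri< i<i′ _ _ =
    ⊥-elim (<-irrefl (trans (sym (Arch.level A)) (Arch.level A′)) (Arch.above A i′ i<i′ (<⇒≤ (Arch.i<j A′))))
  ... | tri> _ _ i′<i =
    ⊥-elim (<-irrefl (trans (sym (Arch.level A′)) (Arch.level A)) (Arch.above A′ i i′<i (<⇒≤ (Arch.i<j A))))

  arches-noncrossing : ∀ {i j i′ j′} → Arch i j → Arch i′ j′ → i < i′ → i′ < j → j < j′ → ⊥
  arches-noncrossing A A′ i<i′ i′<j j<j′ =
    <-irrefl (sym (Arch.level A)) (<-trans (Arch.above A _ i<i′ (<⇒≤ i′<j)) (Arch.above A′ _ (<-trans i′<j ≤-refl) j<j′))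

  partner : ℕ → ℕ
  partner i with stepAt w i
  ... | N = searchUp (λ j → height (suc j) ≤ᵇ height i) (suc i) m
  ... | E = searchDown (λ k → height k ≤ᵇ height (suc i)) (i ∸ 1)

  N⇒<m : ∀ i → stepAt w i ≡ N → i < m
  N⇒<m i q with i <? m
  ... | yes p = p
  ... | no p = ⊥-elim (N≢E (trans (sym q) (beyond w i (≮⇒≥ p))))
    where
    beyond : ∀ {k} (v : Vec Step k) i → k ≤ i → stepAt v i ≡ E
    beyond [] i _ = refl
    beyond (s ∷ v) (suc i) (s≤s p) = beyond v i p

  partner-of-N : ∀ i → stepAt w i ≡ N → partner i ≡ searchUp (λ j → height (suc j) ≤ᵇ height i) (suc i) m
  partner-of-N i q with stepAt w i
  partner-of-N i refl | N = refl

  partner-of-E : ∀ i → stepAt w i ≡ E → partner i ≡ searchDown (λ k → height k ≤ᵇ height (suc i)) (i ∸ 1)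
  partner-of-E i q with stepAt w i
  partner-of-E i refl | E = refl

  arch-of-N : ∀ i → stepAt w i ≡ N → Arch i (partner i)
  arch-of-N i q = subst (Arch i) (sym (partner-of-N i q)) (arch-of-first-return i<r r<m (≤ᵇ-sound (Found.holds F)) above)
    where
    returns : ℕ → Bool
    returns j = height (suc j) ≤ᵇ height i
    i<m : i < m
    i<m = N⇒<m i q
    rises : height (suc i) ≡ suc (height i)
    rises = height-N i i<m q
    2+i≤m : suc (suc i) ≤ m
    2+i≤m with m≤n⇒m<n∨m≡n i<m
    ... | inj₁ p = p
    ... | inj₂ e = ⊥-elim (1+n≢0 (trans (sym rises) (height-end (suc i) (≤-reflexive (sym e)))))
    1+pred-m : suc (m ∸ 1) ≡ m
    1+pred-m = m+[n∸m]≡n {1} {m} (≤-trans (s≤s z≤n) i<m)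
    reach : suc i + (m ∸ 1 ∸ suc i) ≡ m ∸ 1
    reach = m+[n∸m]≡n (∸-monoˡ-≤ 1 2+i≤m)
    back : returns (suc i + (m ∸ 1 ∸ suc i)) ≡ true
    back rewrite reach | 1+pred-m | height-end m ≤-refl = refl
    r : ℕ
    r = searchUp returns (suc i) m
    F : Found returns (suc i) r (suc i + (m ∸ 1 ∸ suc i))
    F = searchUp-finds returns (suc i) m (m ∸ 1 ∸ suc i) (≤-trans (m∸n≤m _ (suc i)) (m∸n≤m m 1)) back
    i<r : i < r
    i<r = Found.lo≤r F
    r<m : r < m
    r<m = subst (r <_) 1+pred-m (s≤s (subst (r ≤_) reach (Found.r≤hi F)))
    above : ∀ t → i < t → t ≤ r → height i < height t
    above (suc t) (s≤s i≤t) t<r with m≤n⇒m<n∨m≡n i≤t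
    ... | inj₂ refl = subst (height i <_) (sym rises) ≤-refl
    ... | inj₁ i<t = ≰⇒> (λ le → false≢true (Found.first F t i<t t<r) (≤ᵇ-true le))

  arch-of-E : ∀ i → i < m → stepAt w i ≡ E → Arch (partner i) i
  arch-of-E i i<m q =
    subst (λ k → Arch k i) (sym (partner-of-E i q)) (arch-of-last-departure r<i i<m (≤ᵇ-sound (FoundLast.holds F)) above)
    where
    leaves : ℕ → Bool
    leaves k = height k ≤ᵇ height (suc i)
    falls : height i ≡ suc (height (suc i))
    falls = height-E i i<m q
    1+pred-i : suc (i ∸ 1) ≡ i
    1+pred-i = m+[n∸m]≡n {1} {i} (n≢0⇒n>0 (λ { refl → 1+n≢0 (trans (sym falls) height-0) }))
    start : leaves 0 ≡ true
    start rewrite height-0 = refl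
    r : ℕ
    r = searchDown leaves (i ∸ 1)
    F : FoundLast leaves r (i ∸ 1)
    F = searchDown-finds leaves (i ∸ 1) start
    r<i : r < i
    r<i = subst (r <_) 1+pred-i (s≤s (FoundLast.r≤hi F))
    above : ∀ t → r < t → t ≤ i → height (suc i) < height t
    above t r<t t≤i with m≤n⇒m<n∨m≡n t≤i
    ... | inj₂ refl = subst (height (suc i) <_) (sym falls) ≤-refl
    ... | inj₁ t<i =
      ≰⇒> (λ le → false≢true (FoundLast.last F t r<t (s≤s⁻¹ (subst (t <_) (sym 1+pred-i) t<i))) (≤ᵇ-true le))

  partner-of-opening : ∀ {i j} → Arch i j → partner i ≡ j
  partner-of-opening A = arch-unique-right (arch-of-N _ (arch-opens-with-N A)) A

  partner-of-closing : ∀ {i j} → Arch i j → partner j ≡ i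
  partner-of-closing A = arch-unique-left (arch-of-E _ (Arch.j<m A) (arch-closes-with-E A)) A

  arch-of : ∀ i → i < m → Arch i (partner i) ⊎ Arch (partner i) i
  arch-of i i<m with step-cases (stepAt w i)
  ... | inj₁ q = inj₁ (arch-of-N i q)
  ... | inj₂ q = inj₂ (arch-of-E i i<m q)

  partner-involutive : ∀ i → i < m → partner (partner i) ≡ i
  partner-involutive i i<m with arch-of i i<m
  ... | inj₁ A = partner-of-closing A
  ... | inj₂ A = partner-of-opening A

  partner<m : ∀ i → i < m → partner i < m
  partner<m i i<m with arch-of i i<m
  ... | inj₁ A = Arch.j<m A
  ... | inj₂ A = <-trans (Arch.i<j A) i<m

  partner≢id : ∀ i → i < m → partner i ≢ i
  partner≢id i i<m e with arch-of i i<m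
  ... | inj₁ A = <-irrefl (sym e) (Arch.i<j A)
  ... | inj₂ A = <-irrefl e (Arch.i<j A)

  <partner⇒arch : ∀ i → i < m → i < partner i → Arch i (partner i)
  <partner⇒arch i i<m i<p with arch-of i i<m
  ... | inj₁ A = A
  ... | inj₂ A = ⊥-elim (<-asym i<p (Arch.i<j A))

  <partner⇒N : ∀ i → i < m → i < partner i → stepAt w i ≡ N
  <partner⇒N i i<m i<p = arch-opens-with-N (<partner⇒arch i i<m i<p)

  partner-noncrossing : ∀ i j → i < m → j < m → i < j → j < partner i → partner i < partner j → ⊥
  partner-noncrossing i j i<m j<m i<j j<pi pi<pj =
    arches-noncrossing (<partner⇒arch i i<m (<-trans i<j j<pi)) (<partner⇒arch j j<m (<-trans j<pi pi<pj)) i<j j<pi pi<pj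

  -- height t + 2 xAt w t = t, so the two ends of an arch, i and j + 1, have the same parity.
  arch-parity : ∀ {i j} → Arch i j → even j ≡ not (even i)
  arch-parity {i} {j} A = trans (sym (not-involutive (even j))) (cong not (trans (sym at-1+j) at-i))
    where
    x′ : ℕ
    x′ = xAt w (suc j)
    at-1+j : even (height i + (x′ + x′)) ≡ even (suc j)
    at-1+j = cong even (trans (cong (_+ (x′ + x′)) (sym (Arch.level A))) (height+2x (suc j) (Arch.j<m A)))
    at-i : even (height i + (x′ + x′)) ≡ even i
    at-i = trans (even-+-double (height i) x′)
                 (trans (sym (even-+-double (height i) (xAt w i)))
                        (cong even (height+2x i (<⇒≤ (<-trans (Arch.i<j A) (Arch.j<m A))))))

  partner-parity : ∀ i → i < m → even (partner i) ≡ not (even i)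
  partner-parity i i<m with arch-of i i<m
  ... | inj₁ A = arch-parity A
  ... | inj₂ A = sym (trans (cong not (arch-parity A)) (not-involutive _))

-- edgeOn τ j is the unit segment whose midpoint lies on the line x + y = τ + ½ and has
-- x-coordinate j / 2: vertical for even j, horizontal for odd j (meaningful when ⌊ j /2⌋ ≤ τ).
edgeOn : ℕ → ℕ → Edge
edgeOn τ j = if even j then V (⌊ j /2⌋) (τ ∸ ⌊ j /2⌋) else H (⌊ j /2⌋) (τ ∸ ⌊ j /2⌋)

edgeOn-double : ∀ τ c → edgeOn τ (c + c) ≡ V c (τ ∸ c)
edgeOn-double τ c rewrite even-double c | ⌊double/2⌋ c = refl

edgeOn-1+double : ∀ τ c → edgeOn τ (suc (c + c)) ≡ H c (τ ∸ c)
edgeOn-1+double τ c rewrite even-1+double c | ⌊1+double/2⌋ c = refl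

edgeOn-2+double : ∀ τ c → edgeOn τ (suc (suc (c + c))) ≡ V (suc c) (τ ∸ suc c)
edgeOn-2+double τ c rewrite not-involutive (even (c + c)) | even-double c | ⌊double/2⌋ c = refl

stepEdge : Step → ℕ → ℕ → Edge
stepEdge N = V
stepEdge E = H

stepEdge-on : ∀ {m} (w : Vec Step m) k → k < m →
  stepEdge (stepAt w k) (xAt w k) (yAt w k) ≡ edgeOn k (xAt w k + xAt w (suc k))
stepEdge-on w k k<m with step-cases (stepAt w k)
... | inj₁ q rewrite q | xAt-N w k k<m q | edgeOn-double k (xAt w k) =
      cong (V (xAt w k)) (sym (trans (cong (_∸ xAt w k) (sym (xAt+yAt w k (<⇒≤ k<m)))) (m+n∸m≡n (xAt w k) (yAt w k))))
... | inj₂ q rewrite q | xAt-E w k k<m q | +-suc (xAt w k) (xAt w k) | edgeOn-1+double k (xAt w k) =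
      cong (H (xAt w k)) (sym (trans (cong (_∸ xAt w k) (sym (xAt+yAt w k (<⇒≤ k<m)))) (m+n∸m≡n (xAt w k) (yAt w k))))

==ᴱ-refl : ∀ e → (e ==ᴱ e) ≡ true
==ᴱ-refl (H a b) rewrite ≡ᵇ-true {a} refl | ≡ᵇ-true {b} refl = refl
==ᴱ-refl (V a b) rewrite ≡ᵇ-true {a} refl | ≡ᵇ-true {b} refl = refl

==ᴱ-sound : ∀ e e′ → (e ==ᴱ e′) ≡ true → e ≡ e′
==ᴱ-sound (H a b) (H c d) h with ∧-split {a ≡ᵇ c} {b ≡ᵇ d} h
... | p , q = cong₂ H (≡ᵇ-sound p) (≡ᵇ-sound q)
==ᴱ-sound (V a b) (V c d) h with ∧-split {a ≡ᵇ c} {b ≡ᵇ d} h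
... | p , q = cong₂ V (≡ᵇ-sound p) (≡ᵇ-sound q)

V-injective : ∀ {a b c d} → V a b ≡ V c d → a ≡ c × b ≡ d
V-injective refl = refl , refl

H-injective : ∀ {a b c d} → H a b ≡ H c d → a ≡ c × b ≡ d
H-injective refl = refl , refl

V≢H : ∀ {a b c d} → V a b ≡ H c d → ⊥
V≢H ()

edgeOn-injective : ∀ τ j τ′ j′ → ⌊ j /2⌋ ≤ τ → ⌊ j′ /2⌋ ≤ τ′ → edgeOn τ j ≡ edgeOn τ′ j′ →
                   τ ≡ τ′ × j ≡ j′
edgeOn-injective τ j τ′ j′ p p′ e with halving j | halving j′
... | twice c | twice c′ with V-injective (trans (sym (edgeOn-double τ c)) (trans e (edgeOn-double τ′ c′)))
...   | refl , q = ∸-cancelʳ-≡ (subst (_≤ τ) (⌊double/2⌋ c) p) (subst (_≤ τ′) (⌊double/2⌋ c) p′) q , refl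
edgeOn-injective τ j τ′ j′ p p′ e | twice c | twice+1 c′ =
  ⊥-elim (V≢H (trans (sym (edgeOn-double τ c)) (trans e (edgeOn-1+double τ′ c′))))
edgeOn-injective τ j τ′ j′ p p′ e | twice+1 c | twice c′ =
  ⊥-elim (V≢H (sym (trans (sym (edgeOn-1+double τ c)) (trans e (edgeOn-double τ′ c′)))))
edgeOn-injective τ j τ′ j′ p p′ e | twice+1 c | twice+1 c′
  with H-injective (trans (sym (edgeOn-1+double τ c)) (trans e (edgeOn-1+double τ′ c′)))
...   | refl , q = ∸-cancelʳ-≡ (subst (_≤ τ) (⌊1+double/2⌋ c) p) (subst (_≤ τ′) (⌊1+double/2⌋ c) p′) q , refl
lookupℕ-pathEdges : ∀ {m} (w : Vec Step m) x y k → k < m →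
  lookupℕ (H 0 0) (pathEdges x y w) k ≡ stepEdge (stepAt w k) (x + xAt w k) (y + yAt w k)
lookupℕ-pathEdges (N ∷ w) x y zero _ rewrite +-identityʳ x | +-identityʳ y = refl
lookupℕ-pathEdges (E ∷ w) x y zero _ rewrite +-identityʳ x | +-identityʳ y = refl
lookupℕ-pathEdges (N ∷ w) x y (suc k) (s≤s p) rewrite lookupℕ-pathEdges w x (suc y) k p | +-suc y (yAt w k) = refl
lookupℕ-pathEdges (E ∷ w) x y (suc k) (s≤s p) rewrite lookupℕ-pathEdges w (suc x) y k p | +-suc x (xAt w k) = refl

-- The billiard map on indices: 0 … M - 1 number the steps of P and M … 2M - 1 those of -Q.
πℕ : ℕ → (ℕ → ℕ) → (ℕ → ℕ) → ℕ → ℕ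
πℕ M u l t = if t <ᵇ M then (if even t then M + t else u t) else (if even (t ∸ M) then M + l (t ∸ M) else t ∸ M)

πℕ-P : ∀ M u l t → t < M → πℕ M u l t ≡ (if even t then M + t else u t)
πℕ-P M u l t p rewrite <ᵇ-true p = refl

πℕ-Q : ∀ M u l k → πℕ M u l (M + k) ≡ (if even k then M + l k else k)
πℕ-Q M u l k rewrite <ᵇ-false {M + k} {M} (λ q → <⇒≱ q (m≤m+n M k)) | m+n∸m≡n M k = refl

module Polygon {n : ℕ} (P Q : Vec Step (n + n)) (dP : isDyck P ≡ true) (dQ : isDyck Q ≡ true) where

  open Billiards {n} P Q

  M : ℕ
  M = n + n

  module DP = DyckMatching P dP
  module DQ = DyckMatching Q dQ

  xP : ℕ → ℕ
  xP = xAt P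
  yQ : ℕ → ℕ
  yQ = yAt Q

  xP-end : xP M ≡ n
  xP-end = double-injective (trans (cong (xP M +_) DP.x≡y-end) (xAt+yAt P M ≤-refl))

  yQ-end : yQ M ≡ n
  yQ-end = double-injective (trans (cong (_+ yQ M) (sym DQ.x≡y-end)) (xAt+yAt Q M ≤-refl))

  x-Q-end : xAt (negPath Q) M ≡ n
  x-Q-end = trans (xAt-negPath Q M) yQ-end

  2xP≤ : ∀ t → t ≤ M → xP t + xP t ≤ t
  2xP≤ t p = ≤-trans (+-monoʳ-≤ (xP t) (DP.x≤y t)) (≤-reflexive (xAt+yAt P t p))

  ≤2yQ : ∀ t → t ≤ M → t ≤ yQ t + yQ t
  ≤2yQ t p = ≤-trans (≤-reflexive (sym (xAt+yAt Q t p))) (+-monoˡ-≤ (yQ t) (DQ.x≤y t))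

  yQ≤n : ∀ s → yQ s ≤ n
  yQ≤n s = subst (yQ s ≤_) yQ-end (yAt≤yAt-end Q s)

  cellInside≡ : ∀ a b → cellInside a b ≡ ((xP (suc (a + b)) ≤ᵇ a) ∧ (a <ᵇ yQ (suc (a + b))))
  cellInside≡ a b with a <? n
  ... | yes a<n = trans (cong₂ _∧_ qpart ppart) (∧-comm (a <ᵇ yQ (suc (a + b))) (xP (suc (a + b)) ≤ᵇ a))
    where
    ppart : (b <ᵇ heightOfEStep 0 a P) ≡ (xP (suc (a + b)) ≤ᵇ a)
    ppart = <heightOfEStep P a b (subst (a <_) (sym xP-end) a<n)
    qpart : (heightOfEStep 0 a (negPath Q) ≤ᵇ b) ≡ (a <ᵇ yQ (suc (a + b)))
    qpart = begin
      heightOfEStep 0 a (negPath Q) ≤ᵇ b           ≡⟨ ≤ᵇ≡not-<ᵇ (heightOfEStep 0 a (negPath Q)) b ⟩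
      not (b <ᵇ heightOfEStep 0 a (negPath Q))     ≡⟨ cong not (<heightOfEStep (negPath Q) a b (subst (a <_) (sym x-Q-end) a<n)) ⟩
      not (xAt (negPath Q) (suc (a + b)) ≤ᵇ a)     ≡⟨ cong (λ x → not (x ≤ᵇ a)) (xAt-negPath Q (suc (a + b))) ⟩
      not (yQ (suc (a + b)) ≤ᵇ a)                  ≡⟨ sym (<ᵇ≡not-≤ᵇ a (yQ (suc (a + b)))) ⟩
      a <ᵇ yQ (suc (a + b))                        ∎
      where open ≡-Reasoning
  ... | no a≮n = trans (cong (λ h → (heightOfEStep 0 a (negPath Q) ≤ᵇ b) ∧ (b <ᵇ h)) beyond-P)
                   (trans (∧-zeroʳ _) (sym (trans (cong ((xP (suc (a + b)) ≤ᵇ a) ∧_) beyond-Q) (∧-zeroʳ _))))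
    where
    beyond-P : heightOfEStep 0 a P ≡ 0
    beyond-P = heightOfEStep-beyond P 0 a (≤-trans (≤-reflexive xP-end) (≮⇒≥ a≮n))
    beyond-Q : (a <ᵇ yQ (suc (a + b))) ≡ false
    beyond-Q = <ᵇ-false (λ q → a≮n (<-≤-trans q (yQ≤n _)))

  Inside : ℕ → ℕ → Set
  Inside a b = xP (suc (a + b)) ≤ a × a < yQ (suc (a + b))

  cellInside-true : ∀ {a b} → Inside a b → cellInside a b ≡ true
  cellInside-true {a} {b} (p , q) = trans (cellInside≡ a b) (∧-intro (≤ᵇ-true p) (<ᵇ-true q))

  cellInside-false : ∀ {a b} → ¬ Inside a b → cellInside a b ≡ false
  cellInside-false {a} {b} np with xP (suc (a + b)) ≤? a | a <? yQ (suc (a + b))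
  ... | yes p | yes q = ⊥-elim (np (p , q))
  ... | no p | _ = trans (cellInside≡ a b) (∧≡false (inj₁ (≤ᵇ-false p)))
  ... | yes _ | no q = trans (cellInside≡ a b) (∧≡false (inj₂ (<ᵇ-false q)))

  inside? : ∀ a b → Dec (Inside a b)
  inside? a b with xP (suc (a + b)) ≤? a | a <? yQ (suc (a + b))
  ... | yes p | yes q = yes (p , q)
  ... | no p | _ = no (λ z → p (proj₁ z))
  ... | yes _ | no q = no (λ z → q (proj₂ z))

  Inside⁺ : ℕ → ℕ → Set
  Inside⁺ τ j = xP (suc τ) ≤ ⌊ j /2⌋ × ⌊ j /2⌋ < yQ (suc τ)

  Inside⁻ : ℕ → ℕ → Set
  Inside⁻ τ zero = ⊥
  Inside⁻ τ (suc j) = xP τ ≤ ⌊ j /2⌋ × ⌊ j /2⌋ < yQ τ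

  cellInside⁺ : ∀ τ j → ⌊ j /2⌋ ≤ τ →
    (Inside⁺ τ j → cellInside (⌊ j /2⌋) (τ ∸ ⌊ j /2⌋) ≡ true) × (¬ Inside⁺ τ j → cellInside (⌊ j /2⌋) (τ ∸ ⌊ j /2⌋) ≡ false)
  cellInside⁺ τ j p = (λ a → cellInside-true (subst Inside-on (sym (m+[n∸m]≡n p)) a))
                    , (λ na → cellInside-false (λ i → na (subst Inside-on (m+[n∸m]≡n p) i)))
    where
    Inside-on : ℕ → Set
    Inside-on s = xP (suc s) ≤ ⌊ j /2⌋ × ⌊ j /2⌋ < yQ (suc s)

  Inside⁻-even : ∀ τ c → Inside⁻ τ (suc (suc (c + c))) ≡ (xP τ ≤ c × c < yQ τ)
  Inside⁻-even τ c = cong (λ h → xP τ ≤ h × h < yQ τ) (⌊1+double/2⌋ c)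

  Inside⁻-odd : ∀ τ c → Inside⁻ τ (suc (c + c)) ≡ (xP τ ≤ c × c < yQ τ)
  Inside⁻-odd τ c = cong (λ h → xP τ ≤ h × h < yQ τ) (⌊double/2⌋ c)

  cellInside-sound : ∀ a b → cellInside a b ≡ true → Inside a b
  cellInside-sound a b h with inside? a b
  ... | yes i = i
  ... | no ni = ⊥-elim (false≢true (cellInside-false ni) h)

  isBoundary-xor : ∀ τ j → ⌊ j /2⌋ ≤ τ →
    Σ Bool λ b → (isBoundary (edgeOn τ j) ≡ (cellInside (⌊ j /2⌋) (τ ∸ ⌊ j /2⌋) xor b))
               × (b ≡ true → Inside⁻ τ j) × (Inside⁻ τ j → b ≡ true)
  isBoundary-xor τ j p with halving j
  ... | twice zero = false , sym (xor-identityʳ _) , (λ ()) , (λ ())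
  ... | twice (suc c) rewrite edgeOn-double τ (suc c) | ⌊double/2⌋ (suc c) | +-suc c c =
        cellInside c (τ ∸ suc c) , refl ,
        (λ h → subst (λ X → X) (sym (Inside⁻-even τ c)) (subst (λ s → xP s ≤ c × c < yQ s) eqτ (cellInside-sound c _ h))) ,
        (λ i → cellInside-true (subst (λ s → xP s ≤ c × c < yQ s) (sym eqτ) (subst (λ X → X) (Inside⁻-even τ c) i)))
    where
    eqτ : suc (c + (τ ∸ suc c)) ≡ τ
    eqτ = m+[n∸m]≡n p
  ... | twice+1 c rewrite edgeOn-1+double τ c | ⌊1+double/2⌋ c = horizontal (τ ∸ c) refl
    where
    horizontal : ∀ y → τ ∸ c ≡ y →
      Σ Bool λ b → (isBoundary (H c y) ≡ (cellInside c y xor b))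
                 × (b ≡ true → Inside⁻ τ (suc (c + c))) × (Inside⁻ τ (suc (c + c)) → b ≡ true)
    horizontal zero e = false , sym (xor-identityʳ _) , (λ ()) ,
      (λ i → ⊥-elim (<⇒≱ (proj₂ (subst (λ X → X) (Inside⁻-odd τ c) i)) (subst (λ t → yQ t ≤ c) (sym τ≡c) (yAt≤t Q c))))
      where
      τ≡c : τ ≡ c
      τ≡c = trans (sym (m+[n∸m]≡n p)) (trans (cong (c +_) e) (+-identityʳ c))
    horizontal (suc y) e = cellInside c y , refl ,
        (λ h → subst (λ X → X) (sym (Inside⁻-odd τ c)) (subst (λ s → xP s ≤ c × c < yQ s) eqτ (cellInside-sound c _ h))) ,
        (λ i → cellInside-true (subst (λ s → xP s ≤ c × c < yQ s) (sym eqτ) (subst (λ X → X) (Inside⁻-odd τ c) i)))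
      where
      eqτ : suc (c + y) ≡ τ
      eqτ = trans (sym (+-suc c y)) (trans (cong (c +_) (sym e)) (m+[n∸m]≡n p))

  interior-edge : ∀ τ j → ⌊ j /2⌋ ≤ τ → Inside⁺ τ j → Inside⁻ τ j → isBoundary (edgeOn τ j) ≡ false
  interior-edge τ j p a b with isBoundary-xor τ j p
  ... | bb , e , _ , f rewrite proj₁ (cellInside⁺ τ j p) a | f b = e

  boundary-edge⁺ : ∀ τ j → ⌊ j /2⌋ ≤ τ → Inside⁺ τ j → ¬ Inside⁻ τ j → isBoundary (edgeOn τ j) ≡ true
  boundary-edge⁺ τ j p a nb with isBoundary-xor τ j p
  ... | false , e , _ , f rewrite proj₁ (cellInside⁺ τ j p) a = e
  ... | true , e , g , f = ⊥-elim (nb (g refl))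

  boundary-edge⁻ : ∀ τ j → ⌊ j /2⌋ ≤ τ → ¬ Inside⁺ τ j → Inside⁻ τ j → isBoundary (edgeOn τ j) ≡ true
  boundary-edge⁻ τ j p na b with isBoundary-xor τ j p
  ... | bb , e , _ , f rewrite proj₂ (cellInside⁺ τ j p) na | f b = e


  step-SE : ∀ τ j → step (edgeOn τ j) (true , false) ≡ edgeOn τ (suc j)
  step-SE τ j with halving j
  ... | twice c rewrite edgeOn-double τ c | edgeOn-1+double τ c = refl
  ... | twice+1 c rewrite edgeOn-1+double τ c | edgeOn-2+double τ c =
        cong (V (suc c)) (trans (∸-+-assoc τ c 1) (cong (τ ∸_) (+-comm c 1)))

  step-NW : ∀ τ j → ⌊ suc j /2⌋ ≤ τ → step (edgeOn τ (suc j)) (false , true) ≡ edgeOn τ j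
  step-NW τ j p with halving j
  ... | twice c rewrite edgeOn-1+double τ c | edgeOn-double τ c = refl
  ... | twice+1 c rewrite edgeOn-2+double τ c | edgeOn-1+double τ c =
    cong (H c) (sym (m∸n≡1+m∸1+n τ c (subst (λ x → suc x ≤ τ) (⌊double/2⌋ c) p)))

  step-NE : ∀ τ j → ⌊ j /2⌋ ≤ τ → step (edgeOn τ j) (true , true) ≡ edgeOn (suc τ) (suc j)
  step-NE τ j p with halving j
  ... | twice c rewrite edgeOn-double τ c | edgeOn-1+double (suc τ) c =
    cong (H c) (sym (+-∸-assoc 1 (subst (_≤ τ) (⌊double/2⌋ c) p)))
  ... | twice+1 c rewrite edgeOn-1+double τ c | edgeOn-2+double (suc τ) c = refl

  step-SW : ∀ τ j → step (edgeOn (suc τ) (suc j)) (false , false) ≡ edgeOn τ j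
  step-SW τ j with halving j
  ... | twice c rewrite edgeOn-1+double (suc τ) c | edgeOn-double τ c =
        cong (V c) (trans (∸-+-assoc (suc τ) c 1) (cong (suc τ ∸_) (+-comm c 1)))
  ... | twice+1 c rewrite edgeOn-2+double (suc τ) c | edgeOn-1+double τ c = refl

  fly-along : ∀ (es : ℕ → Edge) d r f → 0 < r → r ≤ f →
    (∀ s → s < r → step (es s) d ≡ es (suc s)) →
    (∀ s → 0 < s → s < r → isBoundary (es s) ≡ false) →
    isBoundary (es r) ≡ true → fly f (es 0) d ≡ es r
  fly-along es d (suc zero) (suc f) _ _ st int bd rewrite st 0 (s≤s z≤n) | bd = refl
  fly-along es d (suc (suc r)) (suc f) _ (s≤s r≤f) st int bd
    rewrite st 0 (s≤s z≤n) | int 1 (s≤s z≤n) (s≤s (s≤s z≤n)) =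
    fly-along (λ s → es (suc s)) d (suc r) f (s≤s z≤n) r≤f (λ s p → st (suc s) (s≤s p))
      (λ s p q → int (suc s) (s≤s z≤n) (s≤s q)) bd

  fly-along-back : ∀ (L : ℕ → Edge) d r f → 0 < r → r ≤ f →
    (∀ s → s < r → step (L (suc s)) d ≡ L s) →
    (∀ s → 0 < s → s < r → isBoundary (L s) ≡ false) →
    isBoundary (L 0) ≡ true → fly f (L r) d ≡ L 0
  fly-along-back L d r f p q st int bd =
    subst (λ x → fly f (L r) d ≡ L x) (n∸n≡0 r)
      (fly-along (λ s → L (r ∸ s)) d r f p q st′ int′ (subst (λ x → isBoundary (L x) ≡ true) (sym (n∸n≡0 r)) bd))
    where
    st′ : ∀ s → s < r → step (L (r ∸ s)) d ≡ L (r ∸ suc s)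
    st′ s s<r = subst (λ x → step (L x) d ≡ L (r ∸ suc s)) (sym (m∸n≡1+m∸1+n r s s<r))
                      (st (r ∸ suc s) (∸-monoʳ-< {r} {suc s} {0} (s≤s z≤n) s<r))
    int′ : ∀ s → 0 < s → s < r → isBoundary (L (r ∸ s)) ≡ false
    int′ s p s<r = int (r ∸ s) (m<n⇒0<n∸m s<r) (∸-monoʳ-< p (<⇒≤ s<r))

  beam-between : ∀ (L : ℕ → Edge) {e₀ e₁} d d′ r → L 0 ≡ e₀ → L r ≡ e₁ → 0 < r → r ≤ M + M →
    (∀ s → s < r → step (L s) d ≡ L (suc s)) → (∀ s → s < r → step (L (suc s)) d′ ≡ L s) →
    (∀ s → 0 < s → s < r → isBoundary (L s) ≡ false) → isBoundary e₀ ≡ true → isBoundary e₁ ≡ true →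
    fly (M + M) e₀ d ≡ e₁ × fly (M + M) e₁ d′ ≡ e₀
  beam-between L d d′ r refl refl 0<r r≤ forth back interior b₀ b₁ =
    fly-along L d r (M + M) 0<r r≤ forth interior b₁ , fly-along-back L d′ r (M + M) 0<r r≤ back interior b₀

  inside⁺-intro : ∀ {τ j} → xP (suc τ) + xP (suc τ) ≤ j → j < yQ (suc τ) + yQ (suc τ) → Inside⁺ τ j
  inside⁺-intro {τ} {j} p q = double≤⇒≤⌊/2⌋ _ j p , <double⇒⌊/2⌋< _ j q

  inside⁻-intro : ∀ {τ j} → xP τ + xP τ < j → j ≤ yQ τ + yQ τ → Inside⁻ τ j
  inside⁻-intro {τ} {suc j} p q = double≤⇒≤⌊/2⌋ _ j (s≤s⁻¹ p) , <double⇒⌊/2⌋< _ j q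

  inside⁺-lower : ∀ {τ j} → Inside⁺ τ j → xP (suc τ) + xP (suc τ) ≤ j
  inside⁺-lower {τ} {j} a = ≤⌊/2⌋⇒double≤ _ j (proj₁ a)

  inside⁺-upper : ∀ {τ j} → Inside⁺ τ j → j < yQ (suc τ) + yQ (suc τ)
  inside⁺-upper {τ} {j} a = ⌊/2⌋<⇒<double _ j (proj₂ a)

  inside⁻-lower : ∀ {τ j} → Inside⁻ τ j → xP τ + xP τ < j
  inside⁻-lower {τ} {suc j} b = s≤s (≤⌊/2⌋⇒double≤ _ j (proj₁ b))

  inside⁻-upper : ∀ {τ j} → Inside⁻ τ j → j ≤ yQ τ + yQ τ
  inside⁻-upper {τ} {suc j} b = ⌊/2⌋<⇒<double _ j (proj₂ b)

  -- The k-th steps of P and of -Q lie on the antidiagonal x + y = k + ½.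
  jP : ℕ → ℕ
  jP k = xP k + xP (suc k)

  jQ : ℕ → ℕ
  jQ k = yQ k + yQ (suc k)

  edgeP : ℕ → Edge
  edgeP k = edgeOn k (jP k)

  edgeQ : ℕ → Edge
  edgeQ k = edgeOn k (jQ k)

  jP≤k : ∀ k → k < M → jP k ≤ k
  jP≤k k k<M = double≤1+double⇒≤ (begin
    jP k + jP k                                    ≡⟨ double-+ (xP k) (xP (suc k)) ⟩
    (xP k + xP k) + (xP (suc k) + xP (suc k))      ≤⟨ +-mono-≤ (2xP≤ k (<⇒≤ k<M)) (2xP≤ (suc k) k<M) ⟩
    k + suc k                                      ≡⟨ +-suc k k ⟩
    suc (k + k)                                    ∎)
    where open ≤-Reasoning

  k<jQ : ∀ k → k < M → k < jQ k
  k<jQ k k<M = double-cancel-< (begin-strict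
    k + k                                          <⟨ n<1+n (k + k) ⟩
    suc (k + k)                                    ≡⟨ sym (+-suc k k) ⟩
    k + suc k                                      ≤⟨ +-mono-≤ (≤2yQ k (<⇒≤ k<M)) (≤2yQ (suc k) k<M) ⟩
    (yQ k + yQ k) + (yQ (suc k) + yQ (suc k))      ≡⟨ sym (double-+ (yQ k) (yQ (suc k))) ⟩
    jQ k + jQ k                                    ∎)
    where open ≤-Reasoning

  jQ≤1+2k : ∀ k → jQ k ≤ suc (k + k)
  jQ≤1+2k k = subst (jQ k ≤_) (+-comm k (suc k)) (+-mono-≤ (yAt≤t Q k) (yAt≤t Q (suc k)))

  jP<jQ : ∀ k → k < M → jP k < jQ k
  jP<jQ k k<M = ≤-<-trans (jP≤k k k<M) (k<jQ k k<M)

  ⌊jP/2⌋ : ∀ k → ⌊ jP k /2⌋ ≡ xP k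
  ⌊jP/2⌋ k = ⌊a+a′/2⌋ (xP k) (xP (suc k)) (xAt-suc-cases P k)

  ⌊jQ/2⌋ : ∀ k → ⌊ jQ k /2⌋ ≡ yQ k
  ⌊jQ/2⌋ k = ⌊a+a′/2⌋ (yQ k) (yQ (suc k)) (yAt-suc-cases Q k)

  ⌊jP/2⌋≤ : ∀ k → ⌊ jP k /2⌋ ≤ k
  ⌊jP/2⌋≤ k = subst (_≤ k) (sym (⌊jP/2⌋ k)) (xAt≤t P k)

  ⌊jQ/2⌋≤ : ∀ k → ⌊ jQ k /2⌋ ≤ k
  ⌊jQ/2⌋≤ k = subst (_≤ k) (sym (⌊jQ/2⌋ k)) (yAt≤t Q k)

  jQ≤2yQ′ : ∀ k → jQ k ≤ yQ (suc k) + yQ (suc k)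
  jQ≤2yQ′ k = +-monoˡ-≤ (yQ (suc k)) (yAt-≤-suc Q k)

  jQ≤1+2yQ : ∀ k → jQ k ≤ suc (yQ k + yQ k)
  jQ≤1+2yQ k = subst (jQ k ≤_) (+-suc (yQ k) (yQ k)) (+-monoʳ-≤ (yQ k) (yAt-suc-≤ Q k))

  2xP≤jP : ∀ k → xP k + xP k ≤ jP k
  2xP≤jP k = +-monoʳ-≤ (xP k) (xAt-≤-suc P k)

  2xP′≤1+jP : ∀ k → xP (suc k) + xP (suc k) ≤ suc (jP k)
  2xP′≤1+jP k = +-monoˡ-≤ (xP (suc k)) (xAt-suc-≤ P k)

  inside⁺-PN : ∀ k → k < M → stepAt P k ≡ N → Inside⁺ k (jP k)
  inside⁺-PN k k<M q = inside⁺-intro (+-monoˡ-≤ (xP (suc k)) (≤-reflexive (xAt-N P k k<M q))) (<-≤-trans (jP<jQ k k<M) (jQ≤2yQ′ k))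

  ¬inside⁺-PE : ∀ k → k < M → stepAt P k ≡ E → ¬ Inside⁺ k (jP k)
  ¬inside⁺-PE k k<M q a = 1+n≰n (subst (_≤ xP k) (xAt-E P k k<M q) (+-cancelʳ-≤ (xP (suc k)) _ _ (inside⁺-lower a)))

  inside⁻-PE : ∀ k → k < M → stepAt P k ≡ E → Inside⁻ k (jP k)
  inside⁻-PE k k<M q = inside⁻-intro (+-monoʳ-< (xP k) (subst (xP k <_) (sym (xAt-E P k k<M q)) ≤-refl))
                         (s≤s⁻¹ (≤-trans (jP<jQ k k<M) (jQ≤1+2yQ k)))

  ¬inside⁻-PN : ∀ k → k < M → stepAt P k ≡ N → ¬ Inside⁻ k (jP k)
  ¬inside⁻-PN k k<M q b = <-irrefl (cong (xP k +_) (sym (xAt-N P k k<M q))) (inside⁻-lower b)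

  inside⁺-QN : ∀ k → k < M → stepAt Q k ≡ N → Inside⁺ k (jQ k)
  inside⁺-QN k k<M q = inside⁺-intro (≤-trans (2xP′≤1+jP k) (jP<jQ k k<M))
                         (subst (λ x → yQ k + x < x + x) (sym (yAt-N Q k k<M q)) (+-monoˡ-< (suc (yQ k)) ≤-refl))

  ¬inside⁻-QN : ∀ k → k < M → stepAt Q k ≡ N → ¬ Inside⁻ k (jQ k)
  ¬inside⁻-QN k k<M q b = <⇒≱ (+-monoʳ-< (yQ k) (subst (yQ k <_) (sym (yAt-N Q k k<M q)) ≤-refl)) (inside⁻-upper b)

  ¬inside⁺-QE : ∀ k → k < M → stepAt Q k ≡ E → ¬ Inside⁺ k (jQ k)
  ¬inside⁺-QE k k<M q a = <-irrefl (cong (yQ k +_) (yAt-E Q k k<M q)) (subst (λ x → jQ k < x + x) (yAt-E Q k k<M q) (inside⁺-upper a))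

  inside⁻-QE : ∀ k → k < M → stepAt Q k ≡ E → Inside⁻ k (jQ k)
  inside⁻-QE k k<M q = inside⁻-intro (≤-<-trans (2xP≤jP k) (jP<jQ k k<M)) (≤-reflexive (cong (yQ k +_) (yAt-E Q k k<M q)))

  edgeP-boundary : ∀ k → k < M → isBoundary (edgeP k) ≡ true
  edgeP-boundary k k<M with step-cases (stepAt P k)
  ... | inj₁ q = boundary-edge⁺ k (jP k) (⌊jP/2⌋≤ k) (inside⁺-PN k k<M q) (¬inside⁻-PN k k<M q)
  ... | inj₂ q = boundary-edge⁻ k (jP k) (⌊jP/2⌋≤ k) (¬inside⁺-PE k k<M q) (inside⁻-PE k k<M q)

  edgeQ-boundary : ∀ k → k < M → isBoundary (edgeQ k) ≡ true
  edgeQ-boundary k k<M with step-cases (stepAt Q k)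
  ... | inj₁ q = boundary-edge⁺ k (jQ k) (⌊jQ/2⌋≤ k) (inside⁺-QN k k<M q) (¬inside⁻-QN k k<M q)
  ... | inj₂ q = boundary-edge⁻ k (jQ k) (⌊jQ/2⌋≤ k) (¬inside⁺-QE k k<M q) (inside⁻-QE k k<M q)

  antidiagonal-interior : ∀ k j → k < M → jP k < j → j < jQ k → isBoundary (edgeOn k j) ≡ false
  antidiagonal-interior k j k<M p q = interior-edge k j (≤1+double⇒⌊/2⌋≤ (≤-trans (<⇒≤ q) (jQ≤1+2k k)))
    (inside⁺-intro (≤-trans (2xP′≤1+jP k) p) (<-≤-trans q (jQ≤2yQ′ k)))
    (inside⁻-intro (≤-<-trans (2xP≤jP k) p) (s≤s⁻¹ (<-≤-trans q (jQ≤1+2yQ k))))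

  htP : ℕ → ℕ
  htP = DP.height
  htQ : ℕ → ℕ
  htQ = DQ.height

  2yQ≡htQ+t : ∀ t → t ≤ M → yQ t + yQ t ≡ htQ t + t
  2yQ≡htQ+t t p = begin
    yQ t + yQ t ≡⟨ cong (yQ t +_) (DQ.y≡height+x t) ⟩
    yQ t + (htQ t + xAt Q t) ≡⟨ cong (yQ t +_) (+-comm (htQ t) (xAt Q t)) ⟩
    yQ t + (xAt Q t + htQ t) ≡⟨ sym (+-assoc (yQ t) (xAt Q t) (htQ t)) ⟩
    (yQ t + xAt Q t) + htQ t ≡⟨ cong (_+ htQ t) (trans (+-comm (yQ t) (xAt Q t)) (xAt+yAt Q t p)) ⟩
    t + htQ t ≡⟨ +-comm t (htQ t) ⟩
    htQ t + t ∎
    where open ≡-Reasoning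

  htQ≤ : ∀ t → htQ t ≤ t
  htQ≤ t = ≤-trans (m∸n≤m (yQ t) (xAt Q t)) (yAt≤t Q t)

  diagonalP-interior : ∀ τ j h → τ < M → h < htP τ → h < htP (suc τ) → j + h ≡ τ →
                       isBoundary (edgeOn τ j) ≡ false
  diagonalP-interior τ j h τ<M p1 p2 e = interior-edge τ j (≤-trans (⌊n/2⌋≤n j) j≤τ) ahead behind
    where
    j≤τ : j ≤ τ
    j≤τ = subst (j ≤_) e (m≤m+n j h)
    ahead : Inside⁺ τ j
    ahead = inside⁺-intro (+≡+⇒≤ (trans (DP.height+2x (suc τ) τ<M) (cong suc (trans (sym e) (+-comm j h)))) p2)
                (≤-trans (s≤s j≤τ) (≤2yQ (suc τ) τ<M))
    behind : Inside⁻ τ j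
    behind = inside⁻-intro (+≡+⇒< (trans (DP.height+2x τ (<⇒≤ τ<M)) (trans (sym e) (+-comm j h))) p1)
                (≤-trans j≤τ (≤2yQ τ (<⇒≤ τ<M)))

  diagonalQ-interior : ∀ τ j g → suc τ ≤ M → g < htQ τ → g < htQ (suc τ) → j ≡ suc (τ + g) →
                       isBoundary (edgeOn τ j) ≡ false
  diagonalQ-interior τ j g τ<M p1 p2 refl =
    interior-edge τ j (≤1+double⇒⌊/2⌋≤ (s≤s (+-monoʳ-≤ τ (<⇒≤ (<-≤-trans p1 (htQ≤ τ)))))) ahead behind
    where
    ahead : Inside⁺ τ (suc (τ + g))
    ahead = inside⁺-intro (≤-trans (2xP≤ (suc τ) τ<M) (s≤s (m≤m+n τ g)))
                (subst (suc (τ + g) <_) (sym (trans (2yQ≡htQ+t (suc τ) τ<M) (+-comm (htQ (suc τ)) (suc τ))))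
                       (+-monoʳ-< (suc τ) p2))
    behind : Inside⁻ τ (suc (τ + g))
    behind = inside⁻-intro (s≤s (≤-trans (2xP≤ τ (<⇒≤ τ<M)) (m≤m+n τ g)))
                (subst (suc (τ + g) ≤_) (sym (trans (2yQ≡htQ+t τ (<⇒≤ τ<M)) (+-comm (htQ τ) τ)))
                       (subst (_≤ τ + htQ τ) (+-suc τ g) (+-monoʳ-≤ τ p1)))

  ≤M⇒≤2M : ∀ {x} → x ≤ M → x ≤ M + M
  ≤M⇒≤2M p = ≤-trans p (m≤m+n _ _)

  -- For an arch (i, j) of P the diagonal y - x = height i + ½ through the midpoint of step i stays
  -- strictly below P until step j and above y = x, hence above -Q: it runs inside the polygon.
  -- Symmetrically for the arches of Q and -Q.
  module ChordP {i j : ℕ} (A : DP.Arch i j) where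
    j<M : j < M
    j<M = DP.Arch.j<m A

    i<j : i < j
    i<j = DP.Arch.i<j A

    i<M : i < M
    i<M = <-trans i<j j<M

    q : stepAt P i ≡ N
    q = DP.arch-opens-with-N A

    h : ℕ
    h = htP i
    line : ℕ → Edge
    line s = edgeOn (i + s) (jP i + s)
    r : ℕ
    r = j ∸ i

    jP-i : jP i ≡ xP i + xP i
    jP-i = cong (xP i +_) (xAt-N P i i<M q)

    jP-i+h : jP i + h ≡ i
    jP-i+h = trans (+-comm (jP i) h) (trans (cong (h +_) jP-i) (DP.height+2x i (<⇒≤ i<M)))

    jP-along : jP i + r ≡ jP j
    jP-along = +-cancelˡ-≡ h _ _ (begin
      h + (jP i + r) ≡⟨ sym (+-assoc h (jP i) r) ⟩
      (h + jP i) + r ≡⟨ cong (_+ r) (trans (+-comm h (jP i)) jP-i+h) ⟩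
      i + r ≡⟨ m+[n∸m]≡n (<⇒≤ i<j) ⟩
      j ≡⟨ sym (DP.height+2x j (<⇒≤ j<M)) ⟩
      htP j + (xP j + xP j) ≡⟨ cong (_+ (xP j + xP j)) (trans (DP.height-E j j<M (DP.arch-closes-with-E A)) (cong suc (DP.Arch.level A))) ⟩
      suc h + (xP j + xP j) ≡⟨ sym (+-suc h (xP j + xP j)) ⟩
      h + suc (xP j + xP j) ≡⟨ cong (h +_) (sym (trans (cong (xP j +_) (xAt-E P j j<M (DP.arch-closes-with-E A))) (+-suc (xP j) (xP j)))) ⟩
      h + jP j ∎)
      where open ≡-Reasoning

    line-0 : line 0 ≡ edgeP i
    line-0 rewrite +-identityʳ i | +-identityʳ (jP i) = refl

    line-r : line r ≡ edgeP j
    line-r rewrite m+[n∸m]≡n (<⇒≤ i<j) | jP-along = refl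

    0<r : 0 < r
    0<r = m<n⇒0<n∸m i<j

    r≤ : r ≤ M + M
    r≤ = ≤M⇒≤2M (≤-trans (m∸n≤m j i) (<⇒≤ j<M))

    i+s<j : ∀ s → s < r → i + s < j
    i+s<j s p = subst (i + s <_) (m+[n∸m]≡n (<⇒≤ i<j)) (+-monoʳ-< i p)

    interior : ∀ s → 0 < s → s < r → isBoundary (line s) ≡ false
    interior s p1 p2 = diagonalP-interior (i + s) (jP i + s) h (<-trans (i+s<j s p2) j<M)
      (DP.Arch.above A (i + s) (subst (_< i + s) (+-identityʳ i) (+-monoʳ-< i p1)) (<⇒≤ (i+s<j s p2)))
      (DP.Arch.above A (suc (i + s)) (s≤s (m≤m+n i s)) (i+s<j s p2))
      (trans (+-assoc (jP i) s h) (trans (cong (jP i +_) (+-comm s h)) (trans (sym (+-assoc (jP i) h s)) (cong (_+ s) jP-i+h))))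

    on-grid : ∀ s → ⌊ jP i + s /2⌋ ≤ i + s
    on-grid s = ≤-trans (⌊n/2⌋≤n _) (+-monoˡ-≤ s (jP≤k i i<M))

    forth : ∀ s → s < r → step (line s) (true , true) ≡ line (suc s)
    forth s _ rewrite +-suc i s | +-suc (jP i) s = step-NE (i + s) (jP i + s) (on-grid s)

    back : ∀ s → s < r → step (line (suc s)) (false , false) ≡ line s
    back s _ rewrite +-suc i s | +-suc (jP i) s = step-SW (i + s) (jP i + s)

    beams : fly (M + M) (edgeP i) (true , true) ≡ edgeP j × fly (M + M) (edgeP j) (false , false) ≡ edgeP i
    beams = beam-between line (true , true) (false , false) r line-0 line-r 0<r r≤ forth back interior (edgeP-boundary i i<M) (edgeP-boundary j j<M)

  module ChordQ {i j : ℕ} (A : DQ.Arch i j) where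
    j<M : j < M
    j<M = DQ.Arch.j<m A

    i<j : i < j
    i<j = DQ.Arch.i<j A

    i<M : i < M
    i<M = <-trans i<j j<M

    q : stepAt Q i ≡ N
    q = DQ.arch-opens-with-N A

    g : ℕ
    g = htQ i
    line : ℕ → Edge
    line s = edgeOn (i + s) (jQ i + s)
    r : ℕ
    r = j ∸ i

    jQ-i : jQ i ≡ suc (i + g)
    jQ-i = begin
      yQ i + yQ (suc i) ≡⟨ cong (yQ i +_) (yAt-N Q i i<M q) ⟩
      yQ i + suc (yQ i) ≡⟨ +-suc (yQ i) (yQ i) ⟩
      suc (yQ i + yQ i) ≡⟨ cong suc (trans (2yQ≡htQ+t i (<⇒≤ i<M)) (+-comm g i)) ⟩
      suc (i + g) ∎
      where open ≡-Reasoning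

    jQ-along : jQ i + r ≡ jQ j
    jQ-along = begin
      jQ i + r ≡⟨ cong (_+ r) jQ-i ⟩
      suc (i + g) + r ≡⟨ cong (λ x → suc (x + r)) (+-comm i g) ⟩
      suc (g + i + r) ≡⟨ cong suc (+-assoc g i r) ⟩
      suc (g + (i + r)) ≡⟨ cong (λ x → suc (g + x)) (m+[n∸m]≡n (<⇒≤ i<j)) ⟩
      suc g + j ≡⟨ cong (_+ j) (sym (trans (DQ.height-E j j<M (DQ.arch-closes-with-E A)) (cong suc (DQ.Arch.level A)))) ⟩
      htQ j + j ≡⟨ sym (2yQ≡htQ+t j (<⇒≤ j<M)) ⟩
      yQ j + yQ j ≡⟨ cong (yQ j +_) (sym (yAt-E Q j j<M (DQ.arch-closes-with-E A))) ⟩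
      jQ j ∎
      where open ≡-Reasoning

    line-0 : line 0 ≡ edgeQ i
    line-0 rewrite +-identityʳ i | +-identityʳ (jQ i) = refl

    line-r : line r ≡ edgeQ j
    line-r rewrite m+[n∸m]≡n (<⇒≤ i<j) | jQ-along = refl

    0<r : 0 < r
    0<r = m<n⇒0<n∸m i<j

    r≤ : r ≤ M + M
    r≤ = ≤M⇒≤2M (≤-trans (m∸n≤m j i) (<⇒≤ j<M))

    i+s<j : ∀ s → s < r → i + s < j
    i+s<j s p = subst (i + s <_) (m+[n∸m]≡n (<⇒≤ i<j)) (+-monoʳ-< i p)

    interior : ∀ s → 0 < s → s < r → isBoundary (line s) ≡ false
    interior s p1 p2 = diagonalQ-interior (i + s) (jQ i + s) g (<-trans (i+s<j s p2) j<M)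
      (DQ.Arch.above A (i + s) (subst (_< i + s) (+-identityʳ i) (+-monoʳ-< i p1)) (<⇒≤ (i+s<j s p2)))
      (DQ.Arch.above A (suc (i + s)) (s≤s (m≤m+n i s)) (i+s<j s p2))
      (trans (cong (_+ s) jQ-i) (cong suc (trans (+-assoc i g s) (trans (cong (i +_) (+-comm g s)) (sym (+-assoc i s g))))))

    jQ-i+s : ∀ s → jQ i + s ≡ suc ((i + s) + g)
    jQ-i+s s = trans (cong (_+ s) jQ-i)
                    (cong suc (trans (+-assoc i g s) (trans (cong (i +_) (+-comm g s)) (sym (+-assoc i s g)))))

    on-grid : ∀ s → ⌊ jQ i + s /2⌋ ≤ i + s
    on-grid s = ≤1+double⇒⌊/2⌋≤ (subst (_≤ suc ((i + s) + (i + s))) (sym (jQ-i+s s))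
                                  (s≤s (+-monoʳ-≤ (i + s) (≤-trans (htQ≤ i) (m≤m+n i s)))))

    forth : ∀ s → s < r → step (line s) (true , true) ≡ line (suc s)
    forth s _ rewrite +-suc i s | +-suc (jQ i) s = step-NE (i + s) (jQ i + s) (on-grid s)

    back : ∀ s → s < r → step (line (suc s)) (false , false) ≡ line s
    back s _ rewrite +-suc i s | +-suc (jQ i) s = step-SW (i + s) (jQ i + s)

    beams : fly (M + M) (edgeQ i) (true , true) ≡ edgeQ j × fly (M + M) (edgeQ j) (false , false) ≡ edgeQ i
    beams = beam-between line (true , true) (false , false) r line-0 line-r 0<r r≤ forth back interior (edgeQ-boundary i i<M) (edgeQ-boundary j j<M)
  indexOf-at : ∀ {K} (v : Vec Edge K) e t → t < K → lookupℕ (H 0 0) v t ≡ e →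
    (∀ t′ → t′ < K → lookupℕ (H 0 0) v t′ ≡ e → t′ ≡ t) →
    Σ (Fin K) λ ι → indexOf v e ≡ just ι × toℕ ι ≡ t
  indexOf-at (x ∷ xs) e zero _ h u rewrite h | ==ᴱ-refl e = fzero , refl , refl
  indexOf-at (x ∷ xs) e (suc t) (s≤s t<K) h u with x ==ᴱ e in eq
  ... | true = ⊥-elim (1+n≢0 (sym (u 0 (s≤s z≤n) (==ᴱ-sound x e eq))))
  ... | false with indexOf-at xs e t t<K h (λ t′ p q → suc-injective (u (suc t′) (s≤s p) q))
  ...   | ι , e1 , e2 rewrite e1 = fsuc ι , refl , cong suc e2

  1+2k≤2M : ∀ k → k < M → suc (k + k) ≤ M + M
  1+2k≤2M k p = ≤-trans (+-monoʳ-≤ (suc k) (<⇒≤ p)) (+-monoˡ-≤ M p)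

  across : ∀ k → k < M → fly (M + M) (edgeP k) (true , false) ≡ edgeQ k × fly (M + M) (edgeQ k) (false , true) ≡ edgeP k
  across k k<M = beam-between L (true , false) (false , true) r L0 Lr (m<n⇒0<n∸m (jP<jQ k k<M)) r≤ forth back interior
                              (edgeP-boundary k k<M) (edgeQ-boundary k k<M)
    where
    L : ℕ → Edge
    L s = edgeOn k (jP k + s)
    r : ℕ
    r = jQ k ∸ jP k
    L0 : L 0 ≡ edgeP k
    L0 rewrite +-identityʳ (jP k) = refl
    Lr : L r ≡ edgeQ k
    Lr rewrite m+[n∸m]≡n (<⇒≤ (jP<jQ k k<M)) = refl
    r≤ : r ≤ M + M
    r≤ = ≤-trans (m∸n≤m (jQ k) (jP k)) (≤-trans (jQ≤1+2k k) (1+2k≤2M k k<M))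
    below-jQ : ∀ s → s < r → suc (jP k + s) ≤ jQ k
    below-jQ s q = subst (jP k + s <_) (m+[n∸m]≡n (<⇒≤ (jP<jQ k k<M))) (+-monoʳ-< (jP k) q)
    forth : ∀ s → s < r → step (L s) (true , false) ≡ L (suc s)
    forth s _ rewrite +-suc (jP k) s = step-SE k (jP k + s)
    back : ∀ s → s < r → step (L (suc s)) (false , true) ≡ L s
    back s q rewrite +-suc (jP k) s = step-NW k (jP k + s) (≤1+double⇒⌊/2⌋≤ (≤-trans (below-jQ s q) (jQ≤1+2k k)))
    interior : ∀ s → 0 < s → s < r → isBoundary (L s) ≡ false
    interior s p q = antidiagonal-interior k (jP k + s) k<M (subst (_< jP k + s) (+-identityʳ (jP k)) (+-monoʳ-< (jP k) p)) (below-jQ s q)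

  emit-V : ∀ τ j → even j ≡ true → ⌊ j /2⌋ ≤ τ →
           emit (edgeOn τ j) ≡ (cellInside (⌊ j /2⌋) (τ ∸ ⌊ j /2⌋) , not (even τ))
  emit-V τ j ej p with halving j
  ... | twice c rewrite edgeOn-double τ c | ⌊double/2⌋ c = cong (λ x → (cellInside c (τ ∸ c) , not (even x))) (m+[n∸m]≡n p)
  ... | twice+1 c rewrite even-1+double c with ej
  ...   | ()

  emit-H : ∀ τ j → even j ≡ false → ⌊ j /2⌋ ≤ τ →
           emit (edgeOn τ j) ≡ (even τ , cellInside (⌊ j /2⌋) (τ ∸ ⌊ j /2⌋))
  emit-H τ j ej p with halving j
  ... | twice+1 c rewrite edgeOn-1+double τ c | ⌊1+double/2⌋ c = cong (λ x → (even x , cellInside c (τ ∸ c))) (m+[n∸m]≡n p)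
  ... | twice c rewrite even-double c with ej
  ...   | ()

  emit-P-N : ∀ k → k < M → stepAt P k ≡ N → emit (edgeP k) ≡ (true , not (even k))
  emit-P-N k k<M q rewrite emit-V k (jP k) (even-+-same (xAt-N P k k<M q)) (⌊jP/2⌋≤ k)
                        | proj₁ (cellInside⁺ k (jP k) (⌊jP/2⌋≤ k)) (inside⁺-PN k k<M q) = refl

  emit-P-E : ∀ k → k < M → stepAt P k ≡ E → emit (edgeP k) ≡ (even k , false)
  emit-P-E k k<M q rewrite emit-H k (jP k) (even-+-suc (xAt-E P k k<M q)) (⌊jP/2⌋≤ k)
                        | proj₂ (cellInside⁺ k (jP k) (⌊jP/2⌋≤ k)) (¬inside⁺-PE k k<M q) = refl

  emit-Q-N : ∀ k → k < M → stepAt Q k ≡ N → emit (edgeQ k) ≡ (even k , true)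
  emit-Q-N k k<M q rewrite emit-H k (jQ k) (even-+-suc (yAt-N Q k k<M q)) (⌊jQ/2⌋≤ k)
                        | proj₁ (cellInside⁺ k (jQ k) (⌊jQ/2⌋≤ k)) (inside⁺-QN k k<M q) = refl

  emit-Q-E : ∀ k → k < M → stepAt Q k ≡ E → emit (edgeQ k) ≡ (false , not (even k))
  emit-Q-E k k<M q rewrite emit-V k (jQ k) (even-+-same (yAt-E Q k k<M q)) (⌊jQ/2⌋≤ k)
                        | proj₂ (cellInside⁺ k (jQ k) (⌊jQ/2⌋≤ k)) (¬inside⁺-QE k k<M q) = refl

  boundary-at-P : ∀ k → k < M → lookupℕ (H 0 0) boundary k ≡ edgeP k
  boundary-at-P k k<M = trans (lookupℕ-++ˡ (H 0 0) (pathEdges 0 0 P) (pathEdges 0 0 (negPath Q)) k k<M)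
                (trans (lookupℕ-pathEdges P 0 0 k k<M) (stepEdge-on P k k<M))

  boundary-at-Q : ∀ k → k < M → lookupℕ (H 0 0) boundary (M + k) ≡ edgeQ k
  boundary-at-Q k k<M = trans (lookupℕ-++ʳ (H 0 0) (pathEdges 0 0 P) (pathEdges 0 0 (negPath Q)) k)
                (trans (lookupℕ-pathEdges (negPath Q) 0 0 k k<M)
                  (trans (stepEdge-on (negPath Q) k k<M) (cong₂ (λ a b → edgeOn k (a + b)) (xAt-negPath Q k) (xAt-negPath Q (suc k)))))

  split-index : ∀ t → t < M + M → (t < M) ⊎ (Σ ℕ λ k → k < M × t ≡ M + k)
  split-index t p with t <? M
  ... | yes q = inj₁ q
  ... | no q with m≤n⇒∃[o]m+o≡n (≮⇒≥ q)
  ...   | k , e = inj₂ (k , +-cancelˡ-< M k M (subst (_< M + M) (sym e) p) , sym e)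

  edgeP-only-at : ∀ t → t < M → ∀ t′ → t′ < M + M → lookupℕ (H 0 0) boundary t′ ≡ edgeP t → t′ ≡ t
  edgeP-only-at t t<M t′ p e with split-index t′ p
  ... | inj₁ q = proj₁ (edgeOn-injective t′ (jP t′) t (jP t) (⌊jP/2⌋≤ t′) (⌊jP/2⌋≤ t) (trans (sym (boundary-at-P t′ q)) e))
  ... | inj₂ (k , k<M , refl) with edgeOn-injective k (jQ k) t (jP t) (⌊jQ/2⌋≤ k) (⌊jP/2⌋≤ t) (trans (sym (boundary-at-Q k k<M)) e)
  ...   | refl , e2 = ⊥-elim (<-irrefl (sym e2) (jP<jQ k k<M))

  edgeQ-only-at : ∀ t → t < M → ∀ t′ → t′ < M + M → lookupℕ (H 0 0) boundary t′ ≡ edgeQ t → t′ ≡ M + t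
  edgeQ-only-at t t<M t′ p e with split-index t′ p
  ... | inj₁ q with edgeOn-injective t′ (jP t′) t (jQ t) (⌊jP/2⌋≤ t′) (⌊jQ/2⌋≤ t) (trans (sym (boundary-at-P t′ q)) e)
  ...   | refl , e2 = ⊥-elim (<-irrefl e2 (jP<jQ t′ q))
  edgeQ-only-at t t<M t′ p e | inj₂ (k , k<M , refl) =
    cong (M +_) (proj₁ (edgeOn-injective k (jQ k) t (jQ t) (⌊jQ/2⌋≤ k) (⌊jQ/2⌋≤ t) (trans (sym (boundary-at-Q k k<M)) e)))

  indexOf-edgeP : ∀ t → t < M → Σ (Fin (M + M)) λ ι → indexOf boundary (edgeP t) ≡ just ι × toℕ ι ≡ t
  indexOf-edgeP t t<M = indexOf-at boundary (edgeP t) t (<-≤-trans t<M (m≤m+n M M)) (boundary-at-P t t<M) (edgeP-only-at t t<M)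

  indexOf-edgeQ : ∀ t → t < M → Σ (Fin (M + M)) λ ι → indexOf boundary (edgeQ t) ≡ just ι × toℕ ι ≡ M + t
  indexOf-edgeQ t t<M = indexOf-at boundary (edgeQ t) (M + t) (+-monoʳ-< M t<M) (boundary-at-Q t t<M) (edgeQ-only-at t t<M)

  -- By the parity convention of emit, the beam from an even step of P or an odd step of -Q runs
  -- along the antidiagonal, and from the other steps along a diagonal.
  beam-P-even : ∀ t → t < M → even t ≡ true → fly (M + M) (edgeP t) (emit (edgeP t)) ≡ edgeQ t
  beam-P-even t t<M et with step-cases (stepAt P t)
  ... | inj₁ q rewrite emit-P-N t t<M q | et = proj₁ (across t t<M)
  ... | inj₂ q rewrite emit-P-E t t<M q | et = proj₁ (across t t<M)

  beam-P-odd : ∀ t → t < M → even t ≡ false → fly (M + M) (edgeP t) (emit (edgeP t)) ≡ edgeP (DP.partner t)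
  beam-P-odd t t<M ot with DP.arch-of t t<M
  ... | inj₁ A rewrite emit-P-N t t<M (DP.arch-opens-with-N A) | ot = proj₁ (ChordP.beams A)
  ... | inj₂ A rewrite emit-P-E t t<M (DP.arch-closes-with-E A) | ot = proj₂ (ChordP.beams A)

  beam-Q-odd : ∀ k → k < M → even k ≡ false → fly (M + M) (edgeQ k) (emit (edgeQ k)) ≡ edgeP k
  beam-Q-odd k k<M ok with step-cases (stepAt Q k)
  ... | inj₁ q rewrite emit-Q-N k k<M q | ok = proj₂ (across k k<M)
  ... | inj₂ q rewrite emit-Q-E k k<M q | ok = proj₂ (across k k<M)

  beam-Q-even : ∀ k → k < M → even k ≡ true → fly (M + M) (edgeQ k) (emit (edgeQ k)) ≡ edgeQ (DQ.partner k)
  beam-Q-even k k<M ek with DQ.arch-of k k<M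
  ... | inj₁ A rewrite emit-Q-N k k<M (DQ.arch-opens-with-N A) | ek = proj₁ (ChordQ.beams A)
  ... | inj₂ A rewrite emit-Q-E k k<M (DQ.arch-closes-with-E A) | ek = proj₂ (ChordQ.beams A)

  π-lands : ∀ i {e e′} t → lookup boundary i ≡ e → fly (M + M) e (emit e) ≡ e′ →
            Σ (Fin (M + M)) (λ ι → indexOf boundary e′ ≡ just ι × toℕ ι ≡ t) → toℕ (π i) ≡ t
  π-lands i t h1 h2 (ι , h3 , h4) rewrite h1 | h2 | h3 = h4

  lookup-boundary-P : ∀ i t → t < M → toℕ i ≡ t → lookup boundary i ≡ edgeP t
  lookup-boundary-P i t t<M refl = trans (lookup≡lookupℕ (H 0 0) boundary i) (boundary-at-P t t<M)

  lookup-boundary-Q : ∀ i k → k < M → toℕ i ≡ M + k → lookup boundary i ≡ edgeQ k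
  lookup-boundary-Q i k k<M e =
    trans (lookup≡lookupℕ (H 0 0) boundary i) (trans (cong (lookupℕ (H 0 0) boundary) e) (boundary-at-Q k k<M))

  π-on-P : ∀ i t → t < M → toℕ i ≡ t → toℕ (π i) ≡ (if even t then M + t else DP.partner t)
  π-on-P i t t<M it with even t in et
  ... | true = π-lands i (M + t) (lookup-boundary-P i t t<M it) (beam-P-even t t<M et) (indexOf-edgeQ t t<M)
  ... | false = π-lands i (DP.partner t) (lookup-boundary-P i t t<M it) (beam-P-odd t t<M et)
                        (indexOf-edgeP (DP.partner t) (DP.partner<m t t<M))

  π-on-Q : ∀ i k → k < M → toℕ i ≡ M + k → toℕ (π i) ≡ (if even k then M + DQ.partner k else k)
  π-on-Q i k k<M ik with even k in ek
  ... | true = π-lands i (M + DQ.partner k) (lookup-boundary-Q i k k<M ik) (beam-Q-even k k<M ek)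
                       (indexOf-edgeQ (DQ.partner k) (DQ.partner<m k k<M))
  ... | false = π-lands i k (lookup-boundary-Q i k k<M ik) (beam-Q-odd k k<M ek) (indexOf-edgeP k k<M)

  toℕ-π : ∀ i → toℕ (π i) ≡ πℕ M DP.partner DQ.partner (toℕ i)
  toℕ-π i with split-index (toℕ i) (toℕ<n i)
  ... | inj₁ t<M = trans (π-on-P i (toℕ i) t<M refl) (sym (πℕ-P M DP.partner DQ.partner (toℕ i) t<M))
  ... | inj₂ (k , k<M , e) =
    trans (π-on-Q i k k<M e) (sym (trans (cong (πℕ M DP.partner DQ.partner) e) (πℕ-Q M DP.partner DQ.partner k)))

-- a and b are the arcs above and below the line, so ρ follows a closed curve two arcs at a time.
module InvolutionPair (n : ℕ) (a b : ℕ → ℕ)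
  (a-bd : ∀ x → x < n + n → a x < n + n) (b-bd : ∀ x → x < n + n → b x < n + n)
  (a-inv : ∀ x → x < n + n → a (a x) ≡ x) (b-inv : ∀ x → x < n + n → b (b x) ≡ x)
  (a-par : ∀ x → x < n + n → even (a x) ≡ not (even x)) (b-par : ∀ x → x < n + n → even (b x) ≡ not (even x)) where

  M : ℕ
  M = n + n

  ρ : ℕ → ℕ
  ρ x = b (a x)

  ρ′ : ℕ → ℕ
  ρ′ x = a (b x)

  ρ-bounded : ∀ x → x < M → ρ x < M
  ρ-bounded x p = b-bd (a x) (a-bd x p)

  ρ^-bounded : ∀ s x → x < M → iter ρ s x < M
  ρ^-bounded zero x p = p
  ρ^-bounded (suc s) x p = ρ-bounded _ (ρ^-bounded s x p)

  ρ-parity : ∀ x → x < M → even (ρ x) ≡ even x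
  ρ-parity x p rewrite b-par (a x) (a-bd x p) | a-par x p = not-involutive (even x)

  ρ^-parity : ∀ s x → x < M → even (iter ρ s x) ≡ even x
  ρ^-parity zero x p = refl
  ρ^-parity (suc s) x p = trans (ρ-parity _ (ρ^-bounded s x p)) (ρ^-parity s x p)

  ρ′ρ : ∀ x → x < M → ρ′ (ρ x) ≡ x
  ρ′ρ x p rewrite b-inv (a x) (a-bd x p) = a-inv x p

  ρ-injective : ∀ x y → x < M → y < M → ρ x ≡ ρ y → x ≡ y
  ρ-injective x y p q e = trans (sym (ρ′ρ x p)) (trans (cong ρ′ e) (ρ′ρ y q))

  ρ^-injective : ∀ s x y → x < M → y < M → iter ρ s x ≡ iter ρ s y → x ≡ y
  ρ^-injective zero x y p q e = e
  ρ^-injective (suc s) x y p q e =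
    ρ^-injective s x y p q (ρ-injective _ _ (ρ^-bounded s x p) (ρ^-bounded s y q) e)

  -- ρ preserves parity, so ⌊_/2⌋ is injective on an orbit of ρ, which therefore has at most n points.
  period : ∀ t → t < M → Σ ℕ λ p → 0 < p × p ≤ n × iter ρ p t ≡ t
  period t t<M with pigeonhole (n<1+n n) (λ s → fromℕ< (<double⇒⌊/2⌋< n (iter ρ (toℕ s) t) (ρ^-bounded (toℕ s) t t<M)))
  ... | s1 , s2 , s1<s2 , e = d , 0<d , d≤n , sym (ρ^-injective a′ t (iter ρ d t) t<M (ρ^-bounded d t t<M) eq)
    where
    a′ b′ d : ℕ
    a′ = toℕ s1
    b′ = toℕ s2
    d = b′ ∸ a′
    0<d : 0 < d
    0<d = m<n⇒0<n∸m s1<s2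
    d≤n : d ≤ n
    d≤n = ≤-trans (m∸n≤m b′ a′) (s≤s⁻¹ (toℕ<n s2))
    same-half : ⌊ iter ρ a′ t /2⌋ ≡ ⌊ iter ρ b′ t /2⌋
    same-half = trans (sym (toℕ-fromℕ< _)) (trans (cong toℕ e) (toℕ-fromℕ< _))
    same-point : iter ρ a′ t ≡ iter ρ b′ t
    same-point = ⌊/2⌋-parity-injective _ _ same-half (trans (ρ^-parity a′ t t<M) (sym (ρ^-parity b′ t t<M)))
    eq : iter ρ a′ t ≡ iter ρ a′ (iter ρ d t)
    eq = trans same-point (trans (cong (λ z → iter ρ z t) (sym (m+[n∸m]≡n (<⇒≤ s1<s2)))) (iter-+ ρ a′ d t))

  module Periodic (t : ℕ) (t<M : t < M) (p : ℕ) (0<p : 0 < p) (per : iter ρ p t ≡ t) where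

    reduce : ∀ s → Σ ℕ λ s′ → s′ < p × iter ρ s t ≡ iter ρ s′ t
    reduce zero = 0 , 0<p , refl
    reduce (suc s) with reduce s
    ... | s′ , s′<p , e with m≤n⇒m<n∨m≡n s′<p
    ...   | inj₁ lt = suc s′ , lt , cong ρ e
    ...   | inj₂ eqp = 0 , 0<p , trans (cong ρ e) (trans (cong (λ z → iter ρ z t) eqp) per)

    periodic-everywhere : ∀ y → iter ρ p (iter ρ y t) ≡ iter ρ y t
    periodic-everywhere y = begin
      iter ρ p (iter ρ y t)  ≡⟨ sym (iter-+ ρ p y t) ⟩
      iter ρ (p + y) t       ≡⟨ cong (λ z → iter ρ z t) (+-comm p y) ⟩
      iter ρ (y + p) t       ≡⟨ iter-+ ρ y p t ⟩
      iter ρ y (iter ρ p t)  ≡⟨ cong (iter ρ y) per ⟩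
      iter ρ y t             ∎
      where open ≡-Reasoning

    p′ : ℕ
    p′ = p ∸ 1

    ρ^p : ∀ x → iter ρ p x ≡ ρ (iter ρ p′ x)
    ρ^p x = cong (λ z → iter ρ z x) (sym (m+[n∸m]≡n {1} {p} 0<p))

    ρ′^≡ρ^ : ∀ s → iter ρ′ s t ≡ iter ρ (s * p′) t
    ρ′^≡ρ^ zero = refl
    ρ′^≡ρ^ (suc s) = begin
      ρ′ (iter ρ′ s t) ≡⟨ cong ρ′ (ρ′^≡ρ^ s) ⟩
      ρ′ (iter ρ (s * p′) t) ≡⟨ cong ρ′ (sym (periodic-everywhere (s * p′))) ⟩
      ρ′ (iter ρ p (iter ρ (s * p′) t)) ≡⟨ cong ρ′ (ρ^p _) ⟩
      ρ′ (ρ (iter ρ p′ (iter ρ (s * p′) t))) ≡⟨ ρ′ρ _ (ρ^-bounded p′ _ (ρ^-bounded (s * p′) t t<M)) ⟩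
      iter ρ p′ (iter ρ (s * p′) t) ≡⟨ sym (iter-+ ρ p′ (s * p′) t) ⟩
      iter ρ (suc s * p′) t ∎
      where open ≡-Reasoning

    b-ρ^≡a-ρ^ : ∀ y → b (iter ρ y t) ≡ a (iter ρ (y + p′) t)
    b-ρ^≡a-ρ^ y = begin
      b (iter ρ y t) ≡⟨ cong b (sym (periodic-everywhere y)) ⟩
      b (iter ρ p (iter ρ y t)) ≡⟨ cong b (ρ^p _) ⟩
      b (b (a (iter ρ p′ (iter ρ y t)))) ≡⟨ b-inv _ (a-bd _ (ρ^-bounded p′ _ (ρ^-bounded y t t<M))) ⟩
      a (iter ρ p′ (iter ρ y t)) ≡⟨ cong a (sym (iter-+ ρ p′ y t)) ⟩
      a (iter ρ (p′ + y) t) ≡⟨ cong (λ z → a (iter ρ z t)) (+-comm p′ y) ⟩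
      a (iter ρ (y + p′) t) ∎
      where open ≡-Reasoning

  LeastOnCurve : ℕ → Set
  LeastOnCurve t = ∀ s → t ≤ iter ρ s t × t ≤ a (iter ρ s t)

  least-of-first-n : ∀ t → t < M → (∀ s → s < n → t ≤ iter ρ s t × t ≤ a (iter ρ s t)) → LeastOnCurve t
  least-of-first-n t t<M h s with period t t<M
  ... | p , 0<p , p≤n , per with Periodic.reduce t t<M p 0<p per s
  ...   | s′ , s′<p , e rewrite e = h s′ (<-≤-trans s′<p p≤n)

  -- On the orbit of t, ρ′ is ρ ^ (p - 1) and b is a ∘ ρ ^ (p - 1): the same curve, read backwards.
  least-reversed : ∀ t → t < M → LeastOnCurve t → ∀ s → t ≤ iter ρ′ s t × t ≤ b (iter ρ′ s t)
  least-reversed t t<M least s with period t t<M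
  ... | p , 0<p , p≤n , per =
    subst (t ≤_) (sym (ρ′^≡ρ^ s)) (proj₁ (least (s * p′))) ,
    subst (t ≤_) (sym (trans (cong b (ρ′^≡ρ^ s)) (b-ρ^≡a-ρ^ (s * p′)))) (proj₂ (least (s * p′ + p′)))
    where open Periodic t t<M p 0<p per

module CycleCount (n : ℕ) (n≥1 : 1 ≤ n) (u l : ℕ → ℕ)
  (u-bd : ∀ x → x < n + n → u x < n + n) (l-bd : ∀ x → x < n + n → l x < n + n)
  (u-inv : ∀ x → x < n + n → u (u x) ≡ x) (l-inv : ∀ x → x < n + n → l (l x) ≡ x)
  (u-par : ∀ x → x < n + n → even (u x) ≡ not (even x)) (l-par : ∀ x → x < n + n → even (l x) ≡ not (even x)) where

  M : ℕ
  M = n + n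

  module U = InvolutionPair n u l u-bd l-bd u-inv l-inv u-par l-par
  module L = InvolutionPair n l u l-bd u-bd l-inv u-inv l-par u-par

  π′ : ℕ → ℕ
  π′ = πℕ M u l

  -- The predicates counted by numCycles and by curves, transported to indices in ℕ.
  leastOnOrbit : ℕ → Bool
  leastOnOrbit t = all (λ k → t ≤ᵇ iter π′ k t) (upTo (suc (M + M)))

  leastOnCurve : ℕ → Bool
  leastOnCurve t = all (λ k → (t ≤ᵇ iter U.ρ k t) ∧ (t ≤ᵇ u (iter U.ρ k t))) (upTo (suc M))

  π′-odd : ∀ x → x < M → even x ≡ false → π′ x ≡ u x
  π′-odd x p e rewrite πℕ-P M u l x p | e = refl

  π′-even : ∀ x → x < M → even x ≡ true → π′ x ≡ M + x
  π′-even x p e rewrite πℕ-P M u l x p | e = refl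

  π′-M+odd : ∀ k → even k ≡ false → π′ (M + k) ≡ k
  π′-M+odd k e rewrite πℕ-Q M u l k | e = refl

  π′-M+even : ∀ k → even k ≡ true → π′ (M + k) ≡ M + l k
  π′-M+even k e rewrite πℕ-Q M u l k | e = refl

  flip-parity : ∀ {x} (f : ℕ → ℕ) → even (f x) ≡ not (even x) → ∀ {b} → even x ≡ b → even (f x) ≡ not b
  flip-parity f h refl = h

  -- From an odd step of P the beam follows an arch of P, crosses to -Q, follows an arch of Q and
  -- crosses back (from an even step the other way round), so four moves of π′ are one move of ρ.
  module FromOdd (x : ℕ) (x<M : x < M) (odd : even x ≡ false) where
    ux<M : u x < M
    ux<M = u-bd x x<M
    even-ux : even (u x) ≡ true
    even-ux = flip-parity u (u-par x x<M) odd

    step₁ : π′ x ≡ u x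
    step₁ = π′-odd x x<M odd
    step₂ : π′ (π′ x) ≡ M + u x
    step₂ rewrite step₁ = π′-even (u x) ux<M even-ux
    step₃ : π′ (π′ (π′ x)) ≡ M + l (u x)
    step₃ rewrite step₂ = π′-M+even (u x) even-ux
    step₄ : π′ (π′ (π′ (π′ x))) ≡ l (u x)
    step₄ rewrite step₃ = π′-M+odd (l (u x)) (flip-parity l (l-par (u x) ux<M) even-ux)

  module FromEven (x : ℕ) (x<M : x < M) (ev : even x ≡ true) where
    odd-lx : even (l x) ≡ false
    odd-lx = flip-parity l (l-par x x<M) ev

    step₁ : π′ x ≡ M + x
    step₁ = π′-even x x<M ev
    step₂ : π′ (π′ x) ≡ M + l x
    step₂ rewrite step₁ = π′-M+even x ev
    step₃ : π′ (π′ (π′ x)) ≡ l x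
    step₃ rewrite step₂ = π′-M+odd (l x) odd-lx
    step₄ : π′ (π′ (π′ (π′ x))) ≡ u (l x)
    step₄ rewrite step₃ = π′-odd (l x) (l-bd x x<M) odd-lx

  π′⁴-odd : ∀ t → t < M → even t ≡ false → ∀ s → iter π′ (s * 4) t ≡ iter U.ρ s t
  π′⁴-odd t p e zero = refl
  π′⁴-odd t p e (suc s) rewrite π′⁴-odd t p e s =
    FromOdd.step₄ _ (U.ρ^-bounded s t p) (trans (U.ρ^-parity s t p) e)

  π′⁴-even : ∀ t → t < M → even t ≡ true → ∀ s → iter π′ (s * 4) t ≡ iter L.ρ s t
  π′⁴-even t p e zero = refl
  π′⁴-even t p e (suc s) rewrite π′⁴-even t p e s =
    FromEven.step₄ _ (L.ρ^-bounded s t p) (trans (L.ρ^-parity s t p) e)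

  n*4≡M+M : n * 4 ≡ M + M
  n*4≡M+M = solve 1 (λ x → x :* con 4 := (x :+ x) :+ (x :+ x)) refl n
    where open Data.Nat.Solver.+-*-Solver

  r+s*4≤M+M : ∀ r s → r < 4 → s < n → r + s * 4 ≤ M + M
  r+s*4≤M+M r s r<4 s<n =
    ≤-trans (+-monoˡ-≤ (s * 4) (s≤s⁻¹ r<4)) (≤-trans (n≤1+n _) (subst (suc s * 4 ≤_) n*4≡M+M (*-monoˡ-≤ 4 s<n)))

  t≤M+ : ∀ {t} → t < M → ∀ x → t ≤ M + x
  t≤M+ t<M x = ≤-trans (<⇒≤ t<M) (m≤m+n M x)

  leastOnOrbit-at : ∀ {t} → leastOnOrbit t ≡ true → ∀ k → k ≤ M + M → t ≤ iter π′ k t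
  leastOnOrbit-at {t} h k p = ≤ᵇ-sound (all-applyUpTo⁻ (λ k → t ≤ᵇ iter π′ k t) (λ x → x) (suc (M + M)) h k (s≤s p))

  leastOnOrbit⇒least-odd : ∀ t → t < M → even t ≡ false → leastOnOrbit t ≡ true → U.LeastOnCurve t
  leastOnOrbit⇒least-odd t t<M odd h = U.least-of-first-n t t<M λ s s<n →
    let open FromOdd (iter U.ρ s t) (U.ρ^-bounded s t t<M) (trans (U.ρ^-parity s t t<M) odd) in
    subst (t ≤_) (π′⁴-odd t t<M odd s) (leastOnOrbit-at h (s * 4) (r+s*4≤M+M 0 s (s≤s z≤n) s<n)) ,
    subst (t ≤_) (trans (cong π′ (π′⁴-odd t t<M odd s)) step₁) (leastOnOrbit-at h (1 + s * 4) (r+s*4≤M+M 1 s (s≤s (s≤s z≤n)) s<n))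

  leastOnOrbit⇒least-even : ∀ t → t < M → even t ≡ true → leastOnOrbit t ≡ true → L.LeastOnCurve t
  leastOnOrbit⇒least-even t t<M ev h = L.least-of-first-n t t<M λ s s<n →
    let open FromEven (iter L.ρ s t) (L.ρ^-bounded s t t<M) (trans (L.ρ^-parity s t t<M) ev) in
    subst (t ≤_) (π′⁴-even t t<M ev s) (leastOnOrbit-at h (s * 4) (r+s*4≤M+M 0 s (s≤s z≤n) s<n)) ,
    subst (t ≤_) (trans (cong (λ z → π′ (π′ (π′ z))) (π′⁴-even t t<M ev s)) step₃)
          (leastOnOrbit-at h (3 + s * 4) (r+s*4≤M+M 3 s (s≤s (s≤s (s≤s (s≤s z≤n)))) s<n))

  least-in-4-steps : ∀ t (x : ℕ → ℕ) → (∀ s → iter π′ (s * 4) t ≡ x s) →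
    (∀ s r → r < 4 → t ≤ iter π′ r (x s)) → leastOnOrbit t ≡ true
  least-in-4-steps t x blocks within =
    all-applyUpTo⁺ (λ k → t ≤ᵇ iter π′ k t) (λ k → k) (suc (M + M)) (λ k _ → ≤ᵇ-true (above k))
    where
    above : ∀ k → t ≤ iter π′ k t
    above k = subst (λ k′ → t ≤ iter π′ k′ t) (sym (m≡m%n+[m/n]*n k 4))
                (subst (t ≤_) (sym (trans (iter-+ π′ (k % 4) ((k / 4) * 4) t) (cong (iter π′ (k % 4)) (blocks (k / 4)))))
                       (within (k / 4) (k % 4) (m%n<n k 4)))

  least⇒leastOnOrbit-odd : ∀ t → t < M → even t ≡ false → U.LeastOnCurve t → leastOnOrbit t ≡ true
  least⇒leastOnOrbit-odd t t<M odd least = least-in-4-steps t (λ s → iter U.ρ s t) (π′⁴-odd t t<M odd) within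
    where
    within : ∀ s r → r < 4 → t ≤ iter π′ r (iter U.ρ s t)
    within s r r<4 = cases r r<4
      where
      open FromOdd (iter U.ρ s t) (U.ρ^-bounded s t t<M) (trans (U.ρ^-parity s t t<M) odd)
      cases : ∀ r → r < 4 → t ≤ iter π′ r (iter U.ρ s t)
      cases 0 _ = proj₁ (least s)
      cases 1 _ rewrite step₁ = proj₂ (least s)
      cases 2 _ rewrite step₂ = t≤M+ t<M _
      cases 3 _ rewrite step₃ = t≤M+ t<M _
      cases (suc (suc (suc (suc r)))) (s≤s (s≤s (s≤s (s≤s ()))))

  least⇒leastOnOrbit-even : ∀ t → t < M → even t ≡ true → L.LeastOnCurve t → leastOnOrbit t ≡ true
  least⇒leastOnOrbit-even t t<M ev least = least-in-4-steps t (λ s → iter L.ρ s t) (π′⁴-even t t<M ev) within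
    where
    within : ∀ s r → r < 4 → t ≤ iter π′ r (iter L.ρ s t)
    within s r r<4 = cases r r<4
      where
      open FromEven (iter L.ρ s t) (L.ρ^-bounded s t t<M) (trans (L.ρ^-parity s t t<M) ev)
      cases : ∀ r → r < 4 → t ≤ iter π′ r (iter L.ρ s t)
      cases 0 _ = proj₁ (least s)
      cases 1 _ rewrite step₁ = t≤M+ t<M _
      cases 2 _ rewrite step₂ = t≤M+ t<M _
      cases 3 _ rewrite step₃ = proj₂ (least s)
      cases (suc (suc (suc (suc r)))) (s≤s (s≤s (s≤s (s≤s ()))))

  leastOnCurve⇒least : ∀ t → t < M → leastOnCurve t ≡ true → U.LeastOnCurve t
  leastOnCurve⇒least t t<M h = U.least-of-first-n t t<M λ s s<n →
    Data.Product.map ≤ᵇ-sound ≤ᵇ-sound (∧-split (all-applyUpTo⁻ _ (λ x → x) (suc M) h s (s≤s (≤-trans (<⇒≤ s<n) (m≤m+n n n)))))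

  least⇒leastOnCurve : ∀ t → U.LeastOnCurve t → leastOnCurve t ≡ true
  least⇒leastOnCurve t least =
    all-applyUpTo⁺ _ (λ x → x) (suc M) (λ k _ → ∧-intro (≤ᵇ-true (proj₁ (least k))) (≤ᵇ-true (proj₂ (least k))))

  leastOnOrbit≡leastOnCurve : ∀ t → t < M → leastOnOrbit t ≡ leastOnCurve t
  leastOnOrbit≡leastOnCurve t t<M with even t in e
  ... | true = ≡true-⇔
        (λ h → least⇒leastOnCurve t (L.least-reversed t t<M (leastOnOrbit⇒least-even t t<M e h)))
        (λ h → least⇒leastOnOrbit-even t t<M e (U.least-reversed t t<M (leastOnCurve⇒least t t<M h)))
  ... | false = ≡true-⇔
        (λ h → least⇒leastOnCurve t (leastOnOrbit⇒least-odd t t<M e h))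
        (λ h → least⇒leastOnOrbit-odd t t<M e (leastOnCurve⇒least t t<M h))

  -- The orbit of a step of -Q reaches a step of P within two moves.
  not-leastOnOrbit-Q : ∀ k → k < M → leastOnOrbit (M + k) ≡ false
  not-leastOnOrbit-Q k k<M with even k in e
  ... | true = all-applyUpTo-false (λ j → M + k ≤ᵇ iter π′ j (M + k)) (λ x → x) (suc (M + M)) 2 (s≤s 2≤M+M)
                  (≤ᵇ-false (λ h → <⇒≱ (<-≤-trans (l-bd k k<M) (m≤m+n M k)) (subst (M + k ≤_) two-moves h)))
    where
    2≤M+M : 2 ≤ M + M
    2≤M+M = ≤-trans (+-mono-≤ n≥1 n≥1) (m≤m+n M M)
    two-moves : π′ (π′ (M + k)) ≡ l k
    two-moves rewrite π′-M+even k e = π′-M+odd (l k) (flip-parity l (l-par k k<M) e)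
  ... | false = all-applyUpTo-false (λ j → M + k ≤ᵇ iter π′ j (M + k)) (λ x → x) (suc (M + M)) 1
                  (s≤s (≤-trans (s≤s z≤n) (≤-trans (+-mono-≤ n≥1 n≥1) (m≤m+n M M))))
                  (≤ᵇ-false (λ h → <⇒≱ (m<n+m k (≤-trans n≥1 (m≤m+n n n))) (subst (M + k ≤_) (π′-M+odd k e) h)))

  count-leastOnOrbit : count (M + M) leastOnOrbit ≡ count M leastOnCurve
  count-leastOnOrbit =
    trans (count-+ M M leastOnOrbit)
          (trans (cong₂ _+_ (count-cong M leastOnOrbit leastOnCurve leastOnOrbit≡leastOnCurve)
                            (count-none M (λ t → leastOnOrbit (M + t)) not-leastOnOrbit-Q))
                 (+-identityʳ _))

numCycles≡count : ∀ {m} (f : Fin m → Fin m) (g : ℕ → ℕ) → (∀ i → toℕ (f i) ≡ g (toℕ i)) →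
  numCycles f ≡ count m (λ t → all (λ k → t ≤ᵇ iter g k t) (upTo (suc m)))
numCycles≡count {m} f g f≈g = countFin≡count m _ _ λ i →
  all-cong _ _ (upTo (suc m)) λ k → cong (toℕ i ≤ᵇ_) (iter-natural f g toℕ f≈g k i)

curves≡count : ∀ {m} (U L : Fin m → Fin m) (u l : ℕ → ℕ) →
  (∀ i → toℕ (U i) ≡ u (toℕ i)) → (∀ i → toℕ (L i) ≡ l (toℕ i)) →
  curves U L ≡ count m (λ t → all (λ k → (t ≤ᵇ iter (λ x → l (u x)) k t) ∧ (t ≤ᵇ u (iter (λ x → l (u x)) k t))) (upTo (suc m)))
curves≡count {m} U L u l U≈u L≈l = countFin≡count m _ _ λ i →
  all-cong _ _ (upTo (suc m)) λ k →
    cong₂ _∧_ (cong (toℕ i ≤ᵇ_) (LU≈lu k i)) (cong (toℕ i ≤ᵇ_) (trans (U≈u _) (cong u (LU≈lu k i))))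
  where
  LU≈lu : ∀ k i → toℕ (iter (λ x → L (U x)) k i) ≡ iter (λ x → l (u x)) k (toℕ i)
  LU≈lu = iter-natural _ _ toℕ (λ x → trans (L≈l (U x)) (cong l (U≈u x)))

traj≡curves : ∀ {n} → 1 ≤ n → (P Q : Vec Step (n + n)) (dP : isDyck P ≡ true) (dQ : isDyck Q ≡ true) →
  (U L : Fin (n + n) → Fin (n + n)) →
  (∀ i → toℕ (U i) ≡ DyckMatching.partner P dP (toℕ i)) → (∀ i → toℕ (L i) ≡ DyckMatching.partner Q dQ (toℕ i)) →
  numCycles (Billiards.π {n} P Q) ≡ curves U L
traj≡curves {n} n≥1 P Q dP dQ U L U≈u L≈l = begin
  numCycles (Billiards.π {n} P Q)         ≡⟨ numCycles≡count (Billiards.π {n} P Q) _ (Polygon.toℕ-π {n} P Q dP dQ) ⟩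
  count (n + n + (n + n)) C.leastOnOrbit  ≡⟨ C.count-leastOnOrbit ⟩
  count (n + n) C.leastOnCurve            ≡⟨ sym (curves≡count U L DP.partner DQ.partner U≈u L≈l) ⟩
  curves U L                              ∎
  where
  open ≡-Reasoning
  module DP = DyckMatching P dP
  module DQ = DyckMatching Q dQ
  module C = CycleCount n n≥1 DP.partner DQ.partner DP.partner<m DQ.partner<m
               DP.partner-involutive DQ.partner-involutive DP.partner-parity DQ.partner-parity

wordOf : ∀ {m} → Vec (Fin m) m → Vec Step m
wordOf v = tabulate (λ i → if toℕ i <ᵇ toℕ (lookup v i) then N else E)

module ArchesOfDyck {m} (w : Vec Step m) (d : isDyck w ≡ true) where
  open DyckMatching w d

  partnerFin : Fin m → Fin m
  partnerFin i = fromℕ< (partner<m (toℕ i) (toℕ<n i))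

  arches : Vec (Fin m) m
  arches = tabulate partnerFin

  toℕ-arches : ∀ i → toℕ (lookup arches i) ≡ partner (toℕ i)
  toℕ-arches i = trans (cong toℕ (lookup∘tabulate partnerFin i)) (toℕ-fromℕ< _)

  arches-isNC : isNCPerfectMatching (lookup arches) ≡ true
  arches-isNC = ∧-intro (all-tabulate⁺ _ (λ i → i) (λ i → ∧-intro (cong not (≡ᵇ-false (no-fixpoint i))) (≡ᵇ-true (involutive i))))
                (all-tabulate⁺ _ (λ i → i) (λ i → all-tabulate⁺ _ (λ j → j) (λ j → cong not (and3-false (λ a b c →
                   partner-noncrossing (toℕ i) (toℕ j) (toℕ<n i) (toℕ<n j) (<ᵇ-sound a)
                     (subst (toℕ j <_) (toℕ-arches i) (<ᵇ-sound b))
                     (subst₂ _<_ (toℕ-arches i) (toℕ-arches j) (<ᵇ-sound c)))))))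
    where
    no-fixpoint : ∀ i → toℕ (lookup arches i) ≢ toℕ i
    no-fixpoint i e = partner≢id (toℕ i) (toℕ<n i) (trans (sym (toℕ-arches i)) e)
    involutive : ∀ i → toℕ (lookup arches (lookup arches i)) ≡ toℕ i
    involutive i = trans (toℕ-arches _) (trans (cong partner (toℕ-arches i)) (partner-involutive (toℕ i) (toℕ<n i)))

  wordOf-arches : wordOf arches ≡ w
  wordOf-arches = trans (tabulate-cong pointwise) (tabulate∘lookup w)
    where
    pointwise : ∀ i → (if toℕ i <ᵇ toℕ (lookup arches i) then N else E) ≡ lookup w i
    pointwise i rewrite toℕ-arches i with toℕ i <? partner (toℕ i)
    ... | yes p rewrite <ᵇ-true p = trans (sym (<partner⇒N (toℕ i) (toℕ<n i) p)) (stepAt-lookup w i)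
    ... | no p rewrite <ᵇ-false p with step-cases (stepAt w (toℕ i))
    ...   | inj₂ q = trans (sym q) (stepAt-lookup w i)
    ...   | inj₁ q = ⊥-elim (p (Arch.i<j (arch-of-N (toℕ i) q)))

module DyckOfArches {m} (v : Vec (Fin m) m) (nc : isNCPerfectMatching (lookup v) ≡ true) where

  f : ℕ → ℕ
  f = lookupℕ 0 (Data.Vec.map toℕ v)

  f-toℕ : ∀ i → f (toℕ i) ≡ toℕ (lookup v i)
  f-toℕ i = trans (sym (lookup≡lookupℕ 0 (Data.Vec.map toℕ v) i)) (lookup-map i toℕ v)

  private
    is : List (Fin m)
    is = toList (allFin m)

    involution : Fin m → Bool
    involution i = not (toℕ (lookup v i) ≡ᵇ toℕ i) ∧ (toℕ (lookup v (lookup v i)) ≡ᵇ toℕ i)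

    uncrossed : Fin m → Fin m → Bool
    uncrossed i j = not ((toℕ i <ᵇ toℕ j) ∧ (toℕ j <ᵇ toℕ (lookup v i)) ∧ (toℕ (lookup v i) <ᵇ toℕ (lookup v j)))

    all-involution : all involution is ≡ true
    all-involution = proj₁ (∧-split {all involution is} {all (λ i → all (uncrossed i) is) is} nc)

    all-uncrossed : all (λ i → all (uncrossed i) is) is ≡ true
    all-uncrossed = proj₂ (∧-split {all involution is} {all (λ i → all (uncrossed i) is) is} nc)

    not≡true : ∀ {x} → not x ≡ true → x ≡ false
    not≡true {false} _ = refl

    toℕ-fromℕ<-f : ∀ {t} (p : t < m) → toℕ (lookup v (fromℕ< p)) ≡ f t
    toℕ-fromℕ<-f p = trans (sym (f-toℕ _)) (cong f (toℕ-fromℕ< p))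

  f<m : ∀ t → t < m → f t < m
  f<m t p = subst (_< m) (toℕ-fromℕ<-f p) (toℕ<n (lookup v (fromℕ< p)))

  private
    involution-at : ∀ (i : Fin m) →
      not (toℕ (lookup v i) ≡ᵇ toℕ i) ≡ true × (toℕ (lookup v (lookup v i)) ≡ᵇ toℕ i) ≡ true
    involution-at i = ∧-split (all-tabulate⁻ involution (λ i → i) all-involution i)

  f≢id : ∀ t → t < m → f t ≢ t
  f≢id t p e =
    false≢true (not≡true (proj₁ (involution-at (fromℕ< p)))) (≡ᵇ-true (trans (toℕ-fromℕ<-f p) (trans e (sym (toℕ-fromℕ< p)))))

  f-involutive : ∀ t → t < m → f (f t) ≡ t
  f-involutive t p = begin
    f (f t)                                    ≡⟨ cong f (sym (toℕ-fromℕ<-f p)) ⟩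
    f (toℕ (lookup v i))                       ≡⟨ f-toℕ (lookup v i) ⟩
    toℕ (lookup v (lookup v i))                ≡⟨ ≡ᵇ-sound (proj₂ (involution-at i)) ⟩
    toℕ i                                      ≡⟨ toℕ-fromℕ< p ⟩
    t                                          ∎
    where
    open ≡-Reasoning
    i : Fin m
    i = fromℕ< p

  f-noncrossing : ∀ s t → s < m → t < m → s < t → t < f s → f s < f t → ⊥
  f-noncrossing s t ps pt s<t t<fs fs<ft = false≢true (not≡true no-crossing)
    (∧-intro (<ᵇ-true (subst₂ _<_ (sym (toℕ-fromℕ< ps)) (sym (toℕ-fromℕ< pt)) s<t))
      (∧-intro (<ᵇ-true (subst₂ _<_ (sym (toℕ-fromℕ< pt)) (sym (toℕ-fromℕ<-f ps)) t<fs))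
               (<ᵇ-true (subst₂ _<_ (sym (toℕ-fromℕ<-f ps)) (sym (toℕ-fromℕ<-f pt)) fs<ft))))
    where
    no-crossing : uncrossed (fromℕ< ps) (fromℕ< pt) ≡ true
    no-crossing = all-tabulate⁻ (uncrossed (fromℕ< ps)) (λ j → j)
                    (all-tabulate⁻ (λ i → all (uncrossed i) is) (λ i → i) all-uncrossed (fromℕ< ps)) (fromℕ< pt)

  w : Vec Step m
  w = wordOf v

  stepAt-w : ∀ t → t < m → stepAt w t ≡ (if t <ᵇ f t then N else E)
  stepAt-w = stepAt-tab _ (λ t → if t <ᵇ f t then N else E) (λ i → cong (λ x → if toℕ i <ᵇ x then N else E) (sym (f-toℕ i)))

  stepAt-w-N : ∀ t → t < m → t < f t → stepAt w t ≡ N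
  stepAt-w-N t p q rewrite stepAt-w t p | <ᵇ-true q = refl

  stepAt-w-E : ∀ t → t < m → ¬ (t < f t) → stepAt w t ≡ E
  stepAt-w-E t p q rewrite stepAt-w t p | <ᵇ-false q = refl

  -- The number of arcs passing over the point t - ½.
  opened : ℕ → ℕ
  opened t = count t (λ s → t ≤ᵇ f s)

  private
    arc-over : ℕ → ℕ → Bool
    arc-over t s = t ≤ᵇ f s

  opened-N : ∀ t → t < m → t < f t → opened (suc t) ≡ suc (opened t)
  opened-N t p t<ft = begin
    count (suc t) (arc-over (suc t))                          ≡⟨ count-snoc t _ ⟩
    count t (arc-over (suc t)) + bool→ℕ (suc t ≤ᵇ f t)        ≡⟨ cong₂ _+_ (count-cong t _ _ same) (cong bool→ℕ (≤ᵇ-true t<ft)) ⟩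
    opened t + 1                                                   ≡⟨ +-comm (opened t) 1 ⟩
    suc (opened t)                                                 ∎
    where
    open ≡-Reasoning
    same : ∀ s → s < t → (suc t ≤ᵇ f s) ≡ (t ≤ᵇ f s)
    same s s<t = ≡true-⇔ (λ h → ≤ᵇ-true (≤-trans (n≤1+n t) (≤ᵇ-sound h))) (λ h → ≤ᵇ-true (≢⇒< (≤ᵇ-sound h)))
      where
      ≢⇒< : t ≤ f s → t < f s
      ≢⇒< t≤fs with m≤n⇒m<n∨m≡n t≤fs
      ... | inj₁ t<fs = t<fs
      ... | inj₂ e = ⊥-elim (<-asym s<t (subst (t <_) (trans (cong f e) (f-involutive s (<-trans s<t p))) t<ft))

  opened-E : ∀ t → t < m → ¬ (t < f t) → opened t ≡ suc (opened (suc t))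
  opened-E t p nl = begin
    count t (arc-over t)                                      ≡⟨ count-one-more t _ _ (f t) ft<t ends-at-t not-over-1+t agree ⟩
    suc (count t (arc-over (suc t)))                          ≡⟨ cong suc (sym not-over-at-t) ⟩
    suc (count t (arc-over (suc t)) + bool→ℕ (suc t ≤ᵇ f t))  ≡⟨ cong suc (sym (count-snoc t (arc-over (suc t)))) ⟩
    suc (count (suc t) (arc-over (suc t)))                    ∎
    where
    open ≡-Reasoning
    ft<t : f t < t
    ft<t with m≤n⇒m<n∨m≡n (≮⇒≥ nl)
    ... | inj₁ x = x
    ... | inj₂ x = ⊥-elim (f≢id t p x)
    not-over-at-t : count t (arc-over (suc t)) + bool→ℕ (suc t ≤ᵇ f t) ≡ count t (arc-over (suc t))
    not-over-at-t = trans (cong (λ b → count t (arc-over (suc t)) + bool→ℕ b) (≤ᵇ-false nl)) (+-identityʳ _)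
    ends-at-t : (t ≤ᵇ f (f t)) ≡ true
    ends-at-t = ≤ᵇ-true (≤-reflexive (sym (f-involutive t p)))
    not-over-1+t : (suc t ≤ᵇ f (f t)) ≡ false
    not-over-1+t = ≤ᵇ-false (λ h → 1+n≰n (subst (suc t ≤_) (f-involutive t p) h))
    agree : ∀ s → s < t → s ≢ f t → (t ≤ᵇ f s) ≡ (suc t ≤ᵇ f s)
    agree s s<t s≢ft = ≡true-⇔ (λ h → ≤ᵇ-true (≢⇒< (≤ᵇ-sound h))) (λ h → ≤ᵇ-true (≤-trans (n≤1+n t) (≤ᵇ-sound h)))
      where
      ≢⇒< : t ≤ f s → t < f s
      ≢⇒< t≤fs with m≤n⇒m<n∨m≡n t≤fs
      ... | inj₁ t<fs = t<fs
      ... | inj₂ e = ⊥-elim (s≢ft (trans (sym (f-involutive s (<-trans s<t p))) (cong f (sym e))))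

  y≡opened+x : ∀ t → t ≤ m → yAt w t ≡ opened t + xAt w t
  y≡opened+x zero _ rewrite xAt-0 w | yAt-0 w = refl
  y≡opened+x (suc t) p with t <? f t
  ... | yes t<ft rewrite yAt-N w t p (stepAt-w-N t p t<ft) | xAt-N w t p (stepAt-w-N t p t<ft) | opened-N t p t<ft =
        cong suc (y≡opened+x t (<⇒≤ p))
  ... | no nl rewrite yAt-E w t p (stepAt-w-E t p nl) | xAt-E w t p (stepAt-w-E t p nl) =
        trans (y≡opened+x t (<⇒≤ p)) (trans (cong (_+ xAt w t) (opened-E t p nl)) (sym (+-suc _ (xAt w t))))

  opened-end : opened m ≡ 0
  opened-end = count-none m _ (λ s p → ≤ᵇ-false (λ h → <⇒≱ (f<m s p) h))

  dyck : isDyck w ≡ true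
  dyck = dyck-intro w 0 (λ t p → subst (xAt w t ≤_) (sym (y≡opened+x t p)) (m≤n+m (xAt w t) (opened t)))
           (sym (trans (y≡opened+x m ≤-refl) (cong (_+ xAt w m) opened-end)))

  still-open : ∀ i t s → i < m → i < t → t ≤ f i → s < i → i ≤ f s → t ≤ f s
  still-open i t s i<m i<t t≤fi s<i i≤fs with m≤n⇒m<n∨m≡n i≤fs
  ... | inj₂ e = ⊥-elim (<-asym s<i (subst (i <_) (trans (cong f e) (f-involutive s (<-trans s<i i<m))) (<-≤-trans i<t t≤fi)))
  ... | inj₁ i<fs with t ≤? f s
  ...   | yes q = q
  ...   | no q = ⊥-elim (f-noncrossing s i (<-trans s<i i<m) i<m s<i i<fs (<-≤-trans (≰⇒> q) t≤fi))

  module _ (dw : isDyck w ≡ true) where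
    open DyckMatching w dw

    height≡opened : ∀ t → t ≤ m → height t ≡ opened t
    height≡opened t p = trans (cong (_∸ xAt w t) (y≡opened+x t p)) (m+n∸n≡m (opened t) (xAt w t))

    opened-after-arc : ∀ i → i < m → i < f i → opened (suc (f i)) ≤ opened i
    opened-after-arc i i<m i<fi = begin
      count (suc j) (arc-over (suc j))                                    ≡⟨ cong (λ x → count x (arc-over (suc j))) (sym i+d≡1+j) ⟩
      count (i + gap) (arc-over (suc j))                                    ≡⟨ count-+ i gap (arc-over (suc j)) ⟩
      count i (arc-over (suc j)) + count gap (λ s → suc j ≤ᵇ f (i + s))     ≡⟨ cong (count i (arc-over (suc j)) +_) none-inside ⟩
      count i (arc-over (suc j)) + 0                                      ≡⟨ +-identityʳ _ ⟩
      count i (arc-over (suc j))                                          ≤⟨ count-mono i (arc-over (suc j)) (arc-over i) over-i ⟩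
      opened i                                                                 ∎
      where
      open ≤-Reasoning
      j gap : ℕ
      j = f i
      gap = suc j ∸ i
      i+d≡1+j : i + gap ≡ suc j
      i+d≡1+j = m+[n∸m]≡n (<⇒≤ (<-trans i<fi ≤-refl))
      over-i : ∀ s → s < i → (suc j ≤ᵇ f s) ≡ true → (i ≤ᵇ f s) ≡ true
      over-i s _ h = ≤ᵇ-true (≤-trans (<⇒≤ (<-trans i<fi ≤-refl)) (≤ᵇ-sound h))
      j<m = f<m i i<m
      inside-not-over : ∀ s → i ≤ s → s ≤ j → suc j ≤ f s → ⊥
      inside-not-over s i≤s s≤j h with m≤n⇒m<n∨m≡n i≤s
      ... | inj₂ refl = 1+n≰n h
      ... | inj₁ i<s with m≤n⇒m<n∨m≡n s≤j
      ...   | inj₂ refl = <-asym i<fi (subst (suc j ≤_) (f-involutive i i<m) h)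
      ...   | inj₁ s<j = f-noncrossing i s i<m (<-trans s<j j<m) i<s s<j h
      none-inside : count gap (λ s → suc j ≤ᵇ f (i + s)) ≡ 0
      none-inside = count-none gap _ λ s s<gap → ≤ᵇ-false λ h →
        inside-not-over (i + s) (m≤m+n i s) (s≤s⁻¹ (subst (i + s <_) i+d≡1+j (+-monoʳ-< i s<gap))) h

    opened-under-arc : ∀ i t → i < m → i < t → t ≤ f i → opened i < opened t
    opened-under-arc i t i<m i<t t≤fi = begin-strict
      opened i                                                      <⟨ n<1+n _ ⟩
      1 + opened i                                                  ≡⟨ +-comm 1 (opened i) ⟩
      opened i + 1                                                  ≤⟨ +-mono-≤ stays-open arc-i ⟩
      count i (arc-over t) + count e (λ s → t ≤ᵇ f (i + s))    ≡⟨ sym (count-+ i e (arc-over t)) ⟩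
      count (i + e) (arc-over t)                               ≡⟨ cong (λ x → count x (arc-over t)) i+e≡t ⟩
      opened t                                                      ∎
      where
      open ≤-Reasoning
      e : ℕ
      e = t ∸ i
      i+e≡t : i + e ≡ t
      i+e≡t = m+[n∸m]≡n (<⇒≤ i<t)
      stays-open : opened i ≤ count i (arc-over t)
      stays-open = count-mono i (arc-over i) (arc-over t) λ s s<i h → ≤ᵇ-true (still-open i t s i<m i<t t≤fi s<i (≤ᵇ-sound h))
      arc-i : 1 ≤ count e (λ s → t ≤ᵇ f (i + s))
      arc-i = count-pos e (λ s → t ≤ᵇ f (i + s)) 0 (m<n⇒0<n∸m i<t) (≤ᵇ-true (subst (λ x → t ≤ f x) (sym (+-identityʳ i)) t≤fi))

    arch-of-f : ∀ i → i < m → i < f i → Arch i (f i)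
    arch-of-f i i<m i<fi = arch-of-first-return i<fi j<m low above
      where
      j<m = f<m i i<m
      low : height (suc (f i)) ≤ height i
      low rewrite height≡opened (suc (f i)) j<m | height≡opened i (<⇒≤ i<m) = opened-after-arc i i<m i<fi
      above : ∀ t → i < t → t ≤ f i → height i < height t
      above t i<t t≤fi rewrite height≡opened i (<⇒≤ i<m) | height≡opened t (≤-trans t≤fi (<⇒≤ j<m)) =
        opened-under-arc i t i<m i<t t≤fi

    partner≡f : ∀ t → t < m → partner t ≡ f t
    partner≡f t p with t <? f t
    ... | yes t<ft = partner-of-opening (arch-of-f t p t<ft)
    ... | no nl = partner-of-closing (subst (Arch (f t)) (f-involutive t p) (arch-of-f (f t) (f<m t p) ft<fft))
      where
      ft<fft : f t < f (f t)
      ft<fft with m≤n⇒m<n∨m≡n (≮⇒≥ nl)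
      ... | inj₁ x = subst (f t <_) (sym (f-involutive t p)) x
      ... | inj₂ x = ⊥-elim (f≢id t p x)

    arches-wordOf : ArchesOfDyck.arches w dw ≡ v
    arches-wordOf = trans (tabulate-cong λ i → toℕ-injective (trans (toℕ-fromℕ< _) (trans (partner≡f (toℕ i) (toℕ<n i)) (f-toℕ i))))
                          (tabulate∘lookup v)
x-N^a : ∀ a {k} (v : Vec Step k) t → t ≤ a → xAt (replicate a N ++ v) t ≡ 0
x-N^a zero v zero _ = xAt-0 v
x-N^a (suc a) v zero _ = refl
x-N^a (suc a) v (suc t) (s≤s p) = x-N^a a v t p

y-N^a : ∀ a {k} (v : Vec Step k) t → t ≤ a → yAt (replicate a N ++ v) t ≡ t
y-N^a zero v zero _ = yAt-0 v
y-N^a (suc a) v zero _ = refl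
y-N^a (suc a) v (suc t) (s≤s p) = cong suc (y-N^a a v t p)

x-N^a+ : ∀ a {k} (v : Vec Step k) s → xAt (replicate a N ++ v) (a + s) ≡ xAt v s
x-N^a+ zero v s = refl
x-N^a+ (suc a) v s = x-N^a+ a v s

y-N^a+ : ∀ a {k} (v : Vec Step k) s → yAt (replicate a N ++ v) (a + s) ≡ a + yAt v s
y-N^a+ zero v s = refl
y-N^a+ (suc a) v s = cong suc (y-N^a+ a v s)

x-E^b : ∀ b s → s ≤ b → xAt (replicate b E) s ≡ s
x-E^b zero zero _ = refl
x-E^b (suc b) zero _ = refl
x-E^b (suc b) (suc s) (s≤s p) = cong suc (x-E^b b s p)

y-E^b : ∀ b s → yAt (replicate b E) s ≡ 0
y-E^b zero s = refl
y-E^b (suc b) zero = refl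
y-E^b (suc b) (suc s) = y-E^b b s

module RainbowL (n : ℕ) where

  L : Vec Step (n + n)
  L = Lword n

  x-L-rising : ∀ t → t ≤ n → xAt L t ≡ 0
  x-L-rising t p = x-N^a n (replicate n E) t p
  y-L-rising : ∀ t → t ≤ n → yAt L t ≡ t
  y-L-rising t p = y-N^a n (replicate n E) t p
  x-L-falling : ∀ s → s ≤ n → xAt L (n + s) ≡ s
  x-L-falling s p = trans (x-N^a+ n (replicate n E) s) (x-E^b n s p)
  y-L-falling : ∀ s → yAt L (n + s) ≡ n
  y-L-falling s = trans (y-N^a+ n (replicate n E) s) (trans (cong (n +_) (y-E^b n s)) (+-identityʳ n))

  split : ∀ t → (t ≤ n) ⊎ (Σ ℕ λ s → 0 < s × t ≡ n + s)
  split t with t ≤? n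
  ... | yes p = inj₁ p
  ... | no p with m≤n⇒∃[o]m+o≡n (<⇒≤ (≰⇒> p))
  ...   | zero , e = ⊥-elim (p (≤-reflexive (trans (sym e) (+-identityʳ n))))
  ...   | suc s , e = inj₂ (suc s , s≤s z≤n , sym e)

  dyck-L : isDyck L ≡ true
  dyck-L = dyck-intro L 0 le (trans (x-L-falling n ≤-refl) (sym (y-L-falling n)))
    where
    le : ∀ t → t ≤ n + n → xAt L t ≤ 0 + yAt L t
    le t p with split t
    ... | inj₁ q rewrite x-L-rising t q = z≤n
    ... | inj₂ (s , _ , refl) rewrite x-L-falling s (+-cancelˡ-≤ n s n p) | y-L-falling s = +-cancelˡ-≤ n s n p

  open DyckMatching L dyck-L

  height-rising : ∀ t → t ≤ n → height t ≡ t
  height-rising t p rewrite x-L-rising t p | y-L-rising t p = refl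

  height-falling : ∀ s → s ≤ n → height (n + s) ≡ n ∸ s
  height-falling s p rewrite x-L-falling s p | y-L-falling s = refl

  rainbow-arch : ∀ t → t < n → Arch t (n + (n ∸ suc t))
  rainbow-arch t t<n = arch-of-first-return t<j j<M low above
    where
    r j : ℕ
    r = n ∸ suc t
    j = n + r
    t<j : t < j
    t<j = <-≤-trans t<n (m≤m+n n r)
    1+r≡n∸t : suc r ≡ n ∸ t
    1+r≡n∸t = sym (m∸n≡1+m∸1+n n t t<n)
    j<M : j < n + n
    j<M = +-monoʳ-< n (≤-trans (≤-reflexive 1+r≡n∸t) (m∸n≤m n t))
    low : height (suc j) ≤ height t
    low rewrite sym (+-suc n r) | height-falling (suc r) (subst (_≤ n) (sym 1+r≡n∸t) (m∸n≤m n t))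
              | height-rising t (<⇒≤ t<n) | 1+r≡n∸t | m∸[m∸n]≡n (<⇒≤ t<n) = ≤-refl
    above : ∀ τ → t < τ → τ ≤ j → height t < height τ
    above τ t<τ τ≤j rewrite height-rising t (<⇒≤ t<n) with split τ
    ... | inj₁ q rewrite height-rising τ q = t<τ
    ... | inj₂ (s , 0<s , refl) rewrite height-falling s (≤-trans (+-cancelˡ-≤ n s r τ≤j) (m∸n≤m n (suc t))) =
          <-≤-trans (subst (t <_) (sym (m∸[m∸n]≡n t<n)) ≤-refl) (∸-monoʳ-≤ n (+-cancelˡ-≤ n s r τ≤j))

  partner-L : ∀ t → t < n + n → partner t ≡ (n + n) ∸ suc t
  partner-L t t<M with t <? n
  ... | yes t<n = trans (partner-of-opening (rainbow-arch t t<n)) (sym (+-∸-assoc n t<n))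
  ... | no t≮n with m≤n⇒∃[o]m+o≡n (≮⇒≥ t≮n)
  ...   | s , refl = trans (partner-of-closing (subst (λ j → Arch k (n + j)) n∸1+k≡s (rainbow-arch k k<n))) (sym M∸1+t≡k)
    where
    s<n : s < n
    s<n = +-cancelˡ-< n s n t<M
    k : ℕ
    k = n ∸ suc s
    1+k≡n∸s : suc k ≡ n ∸ s
    1+k≡n∸s = sym (m∸n≡1+m∸1+n n s s<n)
    k<n : k < n
    k<n = <-≤-trans (≤-reflexive 1+k≡n∸s) (m∸n≤m n s)
    n∸1+k≡s : n ∸ suc k ≡ s
    n∸1+k≡s = trans (cong (n ∸_) 1+k≡n∸s) (m∸[m∸n]≡n (<⇒≤ s<n))
    M∸1+t≡k : (n + n) ∸ suc (n + s) ≡ k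
    M∸1+t≡k = trans (cong ((n + n) ∸_) (sym (+-suc n s))) ([m+n]∸[m+o]≡n∸o n n (suc s))

module ArchBijection (n : ℕ) where

  toArches : DyckPath n → ArchSystem (n + n)
  toArches (w , d) = ArchesOfDyck.arches w (T⇒≡true d) , ≡true⇒T (ArchesOfDyck.arches-isNC w (T⇒≡true d))

  fromArches : ArchSystem (n + n) → DyckPath n
  fromArches (v , h) = wordOf v , ≡true⇒T (DyckOfArches.dyck v (T⇒≡true h))

  toArches-fromArches : ∀ y → toArches (fromArches y) ≡ y
  toArches-fromArches (v , h) =
    Σ-T-≡ (λ z → isNCPerfectMatching (lookup z))
          (DyckOfArches.arches-wordOf v (T⇒≡true h) (T⇒≡true (≡true⇒T (DyckOfArches.dyck v (T⇒≡true h)))))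

  fromArches-toArches : ∀ x → fromArches (toArches x) ≡ x
  fromArches-toArches (w , d) = Σ-T-≡ isDyck (ArchesOfDyck.wordOf-arches w (T⇒≡true d))

  dyck⤖arches : DyckPath n ⤖ ArchSystem (n + n)
  dyck⤖arches = ↔⇒⤖ (mk↔ₛ′ toArches fromArches toArches-fromArches fromArches-toArches)

theorem1p1 : (n : ℕ) → 1 ≤ n →
    (Σ[ φ ∈ (DyckPath n × DyckPath n) ⤖ Meander n ]
       ((P Q : DyckPath n) → traj {n} P Q ≡ compM {n} (Bijection.to φ (P , Q))))
    × (Σ[ ψ ∈ DyckPath n ⤖ Semimeander n ]
       ((P : DyckPath n) → traj₁ {n} P ≡ compS {n} (Bijection.to ψ P)))
theorem1p1 n n≥1 = ((ψ ×-⤖ ψ) , traj≡compM) , (ψ , traj₁≡compS)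
  where
  open ArchBijection n
  ψ : DyckPath n ⤖ ArchSystem (n + n)
  ψ = dyck⤖arches
  traj≡compM : (P Q : DyckPath n) → traj {n} P Q ≡ compM {n} (toArches P , toArches Q)
  traj≡compM (P , dP) (Q , dQ) =
    traj≡curves {n} n≥1 P Q (T⇒≡true dP) (T⇒≡true dQ) _ _
      (ArchesOfDyck.toℕ-arches P (T⇒≡true dP)) (ArchesOfDyck.toℕ-arches Q (T⇒≡true dQ))
  traj₁≡compS : (P : DyckPath n) → traj₁ {n} P ≡ compS {n} (toArches P)
  traj₁≡compS (P , dP) =
    traj≡curves {n} n≥1 P (Lword n) (T⇒≡true dP) (RainbowL.dyck-L n) _ opposite
      (ArchesOfDyck.toℕ-arches P (T⇒≡true dP))
      (λ i → trans (opposite-prop i) (sym (RainbowL.partner-L n (toℕ i) (toℕ<n i))))
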